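{- Let $k>0$ and $\alpha=(\alpha_1,\dots,\alpha_r)\in[k]^r$ with $\alpha_1+\cdots+\alpha_r=n$. With respect to the neglex term order, the following monomials lie in the initial ideal $\mathrm{in}_<(J_{\alpha,k})$: (i) the reverse skip monomial $\mathbf{x}(S)^*$ for every $S\subseteq[n]$ with $|S|=n-k+1$; (ii) the variable power $x_{\alpha_1+\cdots+\alpha_{i-1}+j}^{\,k-j+1}$ for every $1\le i\le r$ and $1\le j\le\alpha_i$. Consequently, the set $\mathcal{M}_{\alpha,k}$ of $\alpha$-nonskip monomials contains the standard monomial basis of $S_{\alpha,k}=\mathbb{Q}[\mathbf{x}_n]/J_{\alpha,k}$.
   Context: $J_{\alpha,k}\subseteq\mathbb{Q}[x_1,\dots,x_n]$ is the ideal generated by $e_n(\mathbf{x}_n),\dots,e_{n-k+1}(\mathbf{x}_n)$ and by $h_{k-\alpha_i+1}(\mathbf{x}^{(i)}_n),\dots,h_k(\mathbf{x}^{(i)}_n)$ for $1\le i\le r$, where $\mathbf{x}^{(i)}_n=(x_{\alpha_1+\cdots+\alpha_{i-1}+1},\dots,x_{\alpha_1+\cdots+\alpha_i})$. The neglex order: $x_1^{a_1}\cdots x_n^{a_n}<x_1^{b_1}\cdots x_n^{b_n}$ iff there is $i$ with $a_i<b_i$ and $a_{i+1}=b_{i+1},\dots,a_n=b_n$. The standard monomial basis is the set of monomials not in the initial ideal. For $S=\{s_1<\cdots<s_t\}\subseteq[n]$ the skip sequence $\gamma(S)=(\gamma_1,\dots,\gamma_n)$ has $\gamma_i=i-j+1$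 if $i=s_j$ and $\gamma_i=0$ if $i\notin S$; the reverse skip monomial is $\mathbf{x}(S)^*=x_1^{\gamma_n}x_2^{\gamma_{n-1}}\cdots x_n^{\gamma_1}$. A monomial $m$ is $\alpha$-nonskip if $\mathbf{x}(S)^*\nmid m$ for every $S\subseteq[n]$ with $|S|=n-k+1$, and $x_{\alpha_1+\cdots+\alpha_{i-1}+j}^{k-j+1}\nmid m$ for all $1\le i\le r$, $1\le j\le\alpha_i$; $\mathcal{M}_{\alpha,k}$ is the set of such monomials. -}

module Defs where

open import Data.Nat as ℕ using (ℕ; zero; suc; _∸_; _≤_; _<_)
open import Data.Rational as ℚ using (ℚ; 0ℚ; 1ℚ)
open import Data.Rational.Properties as ℚP using ()
open import Data.Fin as Fin using (Fin; toℕ)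
open import Data.Fin.Subset using (Subset)
open import Data.Bool using (Bool; true; false)
open import Data.Vec as Vec using (Vec; []; _∷_; lookup; zipWith; replicate; reverse; _[_]≔_)
open import Data.Vec.Properties using (≡-dec)
open import Data.List as List using (List; []; _∷_; map; concatMap; zip; take; drop; length)
open import Data.List.Relation.Unary.All using (All)
open import Data.Product using (Σ; _×_; _,_; proj₁; proj₂)
open import Data.Sum using (_⊎_)
open import Relation.Nullary using (¬_; yes; no)
open import Relation.Binary.PropositionalEquality using (_≡_; _≢_)

-- Monomials in x₁,…,xₙ : exponent vectors (variable x_{p+1} ↔ index p : Fin n)

Mon : ℕ → Set
Mon n = Vec ℕ n

monMul : ∀ {n} → Mon n → Mon n → Mon n
monMul = zipWith ℕ._+_

_∣ᵐ_ : ∀ {n} → Mon n → Mon n → Set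
_∣ᵐ_ {n} a b = ∀ (p : Fin n) → lookup a p ≤ lookup b p

varPow : ∀ {n} → Fin n → ℕ → Mon n
varPow {n} v e = replicate n 0 [ v ]≔ e

NegLex< : ∀ {n} → Mon n → Mon n → Set
NegLex< {n} a b = Σ (Fin n) λ i → (lookup a i < lookup b i) ×
                    (∀ (j : Fin n) → i Fin.< j → lookup a j ≡ lookup b j)

-- Polynomials in ℚ[x₁,…,xₙ] as finite formal sums of terms (coefficient, monomial);
-- two polynomials are equal when all their coefficients agree.

Poly : ℕ → Set
Poly n = List (ℚ × Mon n)

coeff : ∀ {n} → Poly n → Mon n → ℚ
coeff [] m = 0ℚ
coeff ((c , m') ∷ p) m with ≡-dec ℕ._≟_ m' m
... | yes _ = c ℚ.+ coeff p m
... | no  _ = coeff p m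

_≈_ : ∀ {n} → Poly n → Poly n → Set
_≈_ {n} p q = ∀ (m : Mon n) → coeff p m ≡ coeff q m

0P : ∀ {n} → Poly n
0P = []

1P : ∀ {n} → Poly n
1P {n} = (1ℚ , replicate n 0) ∷ []

mono : ∀ {n} → Mon n → Poly n
mono m = (1ℚ , m) ∷ []

var : ∀ {n} → Fin n → Poly n
var v = mono (varPow v 1)

_+P_ : ∀ {n} → Poly n → Poly n → Poly n
p +P q = p List.++ q

_*P_ : ∀ {n} → Poly n → Poly n → Poly n
p *P q = concatMap (λ t → map (λ s → (proj₁ t ℚ.* proj₁ s , monMul (proj₂ t) (proj₂ s))) q) p

sumP : ∀ {n} → List (Poly n) → Poly n
sumP = List.foldr _+P_ 0P

InIdeal : ∀ {n} → (Poly n → Set) → Poly n → Set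
InIdeal {n} G p = Σ (List (Poly n × Poly n)) λ cs →
  All (λ qg → G (proj₂ qg)) cs × (p ≈ sumP (map (λ qg → proj₁ qg *P proj₂ qg) cs))

LeadMon : ∀ {n} → Poly n → Mon n → Set
LeadMon {n} f m = (coeff f m ≢ 0ℚ) ×
  (∀ (m' : Mon n) → coeff f m' ≢ 0ℚ → (m' ≡ m) ⊎ NegLex< m' m)

InitGen : ∀ {n} → (Poly n → Set) → Poly n → Set
InitGen {n} G g = Σ (Poly n) λ f → Σ (Mon n) λ m →
  InIdeal G f × LeadMon f m × (g ≈ mono m)

InInitial : ∀ {n} → (Poly n → Set) → Poly n → Set
InInitial G = InIdeal (InitGen G)

elem : ∀ {n} → ℕ → List (Fin n) → Poly n
elem zero    []       = 1P
elem (suc d) []       = 0P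
elem zero    (v ∷ vs) = elem zero vs
elem (suc d) (v ∷ vs) = elem (suc d) vs +P (var v *P elem d vs)

hom : ∀ {n} → ℕ → List (Fin n) → Poly n
hom zero    _        = 1P
hom (suc d) []       = 0P
hom (suc d) (v ∷ vs) = hom (suc d) vs +P (var v *P hom d (v ∷ vs))

-- Variable blocks x^{(i)} : split x₁,…,xₙ into consecutive chunks of sizes α₁,…,α_r

chunks : ∀ {A : Set} → List ℕ → List A → List (List A)
chunks []       xs = []
chunks (a ∷ as) xs = take a xs ∷ chunks as (drop a xs)

allVars : ∀ n → List (Fin n)
allVars n = List.allFin n

blocks : ∀ n → List ℕ → List (ℕ × List (Fin n))
blocks n α = zip α (chunks α (allVars n))

open import Data.List.Membership.Propositional using (_∈_)

JGen : ∀ n → (k : ℕ) → List ℕ → Poly n → Set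
JGen n k α g =
  -- e_d(x_n) for n-k+1 ≤ d ≤ n   (d ≥ 0)
  (Σ ℕ λ d → (d ≤ n) × (n < d ℕ.+ k) × (g ≡ elem d (allVars n)))
  ⊎
  -- h_d(x^{(i)}) for k-αᵢ+1 ≤ d ≤ k
  (Σ (ℕ × List (Fin n)) λ b → (b ∈ blocks n α) ×
     (Σ ℕ λ d → (d ≤ k) × (k < d ℕ.+ proj₁ b) × (g ≡ hom d (proj₂ b))))

-- go i c s : i = 0-based position, c = number of elements of S already seen
skipGo : ∀ {m} → ℕ → ℕ → Vec Bool m → Vec ℕ m
skipGo i c []          = []
skipGo i c (true  ∷ s) = (suc i ∸ c) ∷ skipGo (suc i) (suc c) s
skipGo i c (false ∷ s) = 0 ∷ skipGo (suc i) c s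

-- γ(S) : γ_i = i - j + 1 if i = s_j, 0 otherwise
skipSeq : ∀ {n} → Subset n → Vec ℕ n
skipSeq = skipGo 0 0

-- x(S)* = x₁^{γₙ} x₂^{γ_{n-1}} ⋯ xₙ^{γ₁}
revSkip : ∀ {n} → Subset n → Mon n
revSkip S = reverse (skipSeq S)

NonSkip : ∀ n → (k : ℕ) → List ℕ → Mon n → Set
NonSkip n k α m =
  (∀ (S : Subset n) → Data.Fin.Subset.∣ S ∣ ℕ.+ k ≡ suc n → ¬ (revSkip S ∣ᵐ m)) ×
  (∀ (b : ℕ × List (Fin n)) → b ∈ blocks n α →
     ∀ (j : Fin (length (proj₂ b))) →
       ¬ (varPow (List.lookup (proj₂ b) j) (k ∸ toℕ j) ∣ᵐ m))

-- (i) For |S| = n-k+1 we exhibit an element of J with leading monomial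
--     x(S)*: the determinant of the matrix whose row for p ∈ S has entries
--     h_{p+1-j}(x₁,…,x_{n-p}).  It lies in J by a Cramer-rule argument
--     (each row, combined with the coefficients (-1)ʲ eⱼ(xₙ), gives an element
--     of J by the identity E·H = E between generating series), and its
--     leading monomial is computed by Laplace expansion along column 0.
-- (ii) For the (j+1)-st variable v of a block, h_{k-j}(first j+1 variables
--     of the block) lies in J by the identity E_Q · H_{P++Q} = H_P, and has
--     leading monomial x_v^{k-j}.
-- (iii) follows since the initial ideal is closed under multiples.
module Submission where

open import Algebra.Bundles using (CommutativeRing)
open import Data.Nat using (ℕ)
open import Data.List using (List)
open import Defs using (Poly)

-- The key computation is the
-- coefficient of a product (cᵗ xᵐᵗ) · q at m, which depends on whether
-- xᵐᵗ divides xᵐ.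
module PolynomialRing where

  open import Defs
  open import Data.Nat as ℕ using (ℕ)
  import Data.Nat.Properties as ℕP
  open import Data.Rational as ℚ using (ℚ; 0ℚ; 1ℚ)
  import Data.Rational.Properties as ℚP
  open import Data.Rational.Solver using (module +-*-Solver)
  open import Data.Vec as Vec using ([]; _∷_)
  open import Data.Vec.Properties using (≡-dec)
  import Data.Vec.Properties as VecP
  open import Data.Empty using (⊥-elim)
  open import Data.List as List using (List; []; _∷_; _++_; map; concatMap)
  import Data.List.Properties as ListP
  open import Data.Product using (_×_; _,_; proj₁; proj₂)
  open import Function using (_∘_)
  open import Relation.Binary.PropositionalEquality
  open import Relation.Nullary using (yes; no)
  open import Algebra.Structures using (IsCommutativeRing)
  open import Algebra.Bundles using (CommutativeRing)
  open +-*-Solver using (solve; _:+_; _:=_)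

  coeff-∷ : ∀ {n} (t : ℚ × Mon n) (p : Poly n) m →
    coeff (t ∷ p) m ≡ coeff (t ∷ []) m ℚ.+ coeff p m
  coeff-∷ (c , m') p m with ≡-dec ℕ._≟_ m' m
  ... | yes _ = cong (ℚ._+ coeff p m) (sym (ℚP.+-identityʳ c))
  ... | no _  = sym (ℚP.+-identityˡ _)

  coeff-++ : ∀ {n} (p q : Poly n) m → coeff (p ++ q) m ≡ coeff p m ℚ.+ coeff q m
  coeff-++ [] q m = sym (ℚP.+-identityˡ _)
  coeff-++ ((c , m') ∷ p) q m with ≡-dec ℕ._≟_ m' m
  ... | yes _ = trans (cong (c ℚ.+_) (coeff-++ p q m)) (sym (ℚP.+-assoc c _ _))
  ... | no _  = coeff-++ p q m

  coeff-term-≡ : ∀ {n} (c : ℚ) {m' m : Mon n} → m' ≡ m → coeff ((c , m') ∷ []) m ≡ c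
  coeff-term-≡ c {m'} {m} e with ≡-dec ℕ._≟_ m' m
  ... | yes _ = ℚP.+-identityʳ c
  ... | no ne = ⊥-elim (ne e)

  coeff-term-≢ : ∀ {n} (c : ℚ) {m' m : Mon n} → m' ≢ m → coeff ((c , m') ∷ []) m ≡ 0ℚ
  coeff-term-≢ c {m'} {m} ne with ≡-dec ℕ._≟_ m' m
  ... | yes e = ⊥-elim (ne e)
  ... | no _  = refl

  negP : ∀ {n} → Poly n → Poly n
  negP = map (λ t → (ℚ.- proj₁ t , proj₂ t))

  coeff-neg : ∀ {n} (p : Poly n) m → coeff (negP p) m ≡ ℚ.- coeff p m
  coeff-neg [] m = refl
  coeff-neg ((c , m') ∷ p) m with ≡-dec ℕ._≟_ m' m
  ... | yes _ = trans (cong (ℚ.- c ℚ.+_) (coeff-neg p m)) (sym (ℚP.neg-distrib-+ c _))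
  ... | no _  = coeff-neg p m

  termMul : ∀ {n} → ℚ × Mon n → ℚ × Mon n → ℚ × Mon n
  termMul t s = (proj₁ t ℚ.* proj₁ s , monMul (proj₂ t) (proj₂ s))

  termMul-comm : ∀ {n} (t s : ℚ × Mon n) → termMul t s ≡ termMul s t
  termMul-comm (a , x) (b , y) = cong₂ _,_ (ℚP.*-comm a b) (VecP.zipWith-comm ℕP.+-comm x y)

  termMul-assoc : ∀ {n} (t s u : ℚ × Mon n) → termMul (termMul t s) u ≡ termMul t (termMul s u)
  termMul-assoc (a , x) (b , y) (c , z) =
    cong₂ _,_ (ℚP.*-assoc a b c) (VecP.zipWith-assoc ℕP.+-assoc x y z)

  data Cofactor {n} (mt m : Mon n) : Set where
    cofactor   : (m₀ : Mon n) → (∀ ms → monMul mt ms ≡ m → ms ≡ m₀) →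
                 monMul mt m₀ ≡ m → Cofactor mt m
    noCofactor : (∀ ms → monMul mt ms ≢ m) → Cofactor mt m

  cofactor? : ∀ {n} (mt m : Mon n) → Cofactor mt m
  cofactor? [] [] = cofactor [] (λ { [] _ → refl }) refl
  cofactor? (a ∷ mt) (b ∷ m) with cofactor? mt m | a ℕ.≤? b
  ... | noCofactor f | _ = noCofactor λ { (x ∷ ms) e → f ms (VecP.∷-injectiveʳ e) }
  ... | cofactor m₀ f e₀ | no a≰b =
    noCofactor λ { (x ∷ ms) e → a≰b (subst (a ℕ.≤_) (VecP.∷-injectiveˡ e) (ℕP.m≤m+n a x)) }
  ... | cofactor m₀ f e₀ | yes a≤b = cofactor ((b ℕ.∸ a) ∷ m₀)
    (λ { (x ∷ ms) e → cong₂ _∷_ (trans (sym (ℕP.m+n∸m≡n a x)) (cong (ℕ._∸ a) (VecP.∷-injectiveˡ e)))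
                                (f ms (VecP.∷-injectiveʳ e)) })
    (cong₂ _∷_ (ℕP.m+[n∸m]≡n a≤b) e₀)

  cofactorCoeff : ∀ {n} (c : ℚ) (q : Poly n) {mt m : Mon n} → Cofactor mt m → ℚ
  cofactorCoeff c q (cofactor m₀ _ _) = c ℚ.* coeff q m₀
  cofactorCoeff c q (noCofactor _)    = 0ℚ

  coeff-termMul : ∀ {n} (c : ℚ) (mt : Mon n) (q : Poly n) m (d : Cofactor mt m) →
    coeff (map (termMul (c , mt)) q) m ≡ cofactorCoeff c q d
  coeff-termMul c mt [] m (cofactor _ _ _) = sym (ℚP.*-zeroʳ c)
  coeff-termMul c mt [] m (noCofactor _)   = refl
  coeff-termMul c mt ((c' , ms) ∷ q) m d with ≡-dec ℕ._≟_ (monMul mt ms) m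
  coeff-termMul c mt ((c' , ms) ∷ q) m (noCofactor f) | yes e = ⊥-elim (f ms e)
  coeff-termMul c mt ((c' , ms) ∷ q) m (noCofactor f) | no _  = coeff-termMul c mt q m (noCofactor f)
  coeff-termMul c mt ((c' , ms) ∷ q) m d@(cofactor m₀ f e₀) | yes e = begin
    c ℚ.* c' ℚ.+ coeff (map (termMul (c , mt)) q) m ≡⟨ cong (c ℚ.* c' ℚ.+_) (coeff-termMul c mt q m d) ⟩
    c ℚ.* c' ℚ.+ c ℚ.* coeff q m₀                   ≡⟨ sym (ℚP.*-distribˡ-+ c c' _) ⟩
    c ℚ.* (c' ℚ.+ coeff q m₀)                       ≡⟨ cong (λ x → c ℚ.* (x ℚ.+ coeff q m₀)) (sym (coeff-term-≡ c' (f ms e))) ⟩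
    c ℚ.* (coeff ((c' , ms) ∷ []) m₀ ℚ.+ coeff q m₀) ≡⟨ cong (c ℚ.*_) (sym (coeff-∷ (c' , ms) q m₀)) ⟩
    c ℚ.* coeff ((c' , ms) ∷ q) m₀                  ∎
    where open ≡-Reasoning
  coeff-termMul c mt ((c' , ms) ∷ q) m d@(cofactor m₀ f e₀) | no ne = begin
    coeff (map (termMul (c , mt)) q) m               ≡⟨ coeff-termMul c mt q m d ⟩
    c ℚ.* coeff q m₀                                 ≡⟨ cong (c ℚ.*_) (sym (ℚP.+-identityˡ _)) ⟩
    c ℚ.* (0ℚ ℚ.+ coeff q m₀)                        ≡⟨ cong (λ x → c ℚ.* (x ℚ.+ coeff q m₀)) (sym (coeff-term-≢ c' ms≢m₀)) ⟩
    c ℚ.* (coeff ((c' , ms) ∷ []) m₀ ℚ.+ coeff q m₀) ≡⟨ cong (c ℚ.*_) (sym (coeff-∷ (c' , ms) q m₀)) ⟩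
    c ℚ.* coeff ((c' , ms) ∷ q) m₀                   ∎
    where open ≡-Reasoning
          ms≢m₀ : ms ≢ m₀
          ms≢m₀ e = ne (trans (cong (monMul mt) e) e₀)

  *-congʳ : ∀ {n} (p : Poly n) {q q'} → q ≈ q' → (p *P q) ≈ (p *P q')
  *-congʳ [] e m = refl
  *-congʳ ((c , mt) ∷ p) {q} {q'} e m = begin
    coeff (map (termMul (c , mt)) q ++ p *P q) m                  ≡⟨ coeff-++ (map (termMul (c , mt)) q) _ m ⟩
    coeff (map (termMul (c , mt)) q) m ℚ.+ coeff (p *P q) m       ≡⟨ cong₂ ℚ._+_ head (*-congʳ p e m) ⟩
    coeff (map (termMul (c , mt)) q') m ℚ.+ coeff (p *P q') m     ≡⟨ sym (coeff-++ (map (termMul (c , mt)) q') _ m) ⟩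
    coeff (map (termMul (c , mt)) q' ++ p *P q') m                ∎
    where
    open ≡-Reasoning
    sameCofactorCoeff : (d : Cofactor mt m) → cofactorCoeff c q d ≡ cofactorCoeff c q' d
    sameCofactorCoeff (cofactor m₀ _ _) = cong (c ℚ.*_) (e m₀)
    sameCofactorCoeff (noCofactor _)    = refl
    d : Cofactor mt m
    d = cofactor? mt m
    head : coeff (map (termMul (c , mt)) q) m ≡ coeff (map (termMul (c , mt)) q') m
    head = trans (coeff-termMul c mt q m d) (trans (sameCofactorCoeff d) (sym (coeff-termMul c mt q' m d)))

  -- Summing a doubly indexed family of terms row by row or column by column
  -- gives the same coefficients; this is commutativity of _*P_.
  coeff-interleave : ∀ {A : Set} {n} (f : A → ℚ × Mon n) (g : A → Poly n) (bs : List A) m →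
    coeff (concatMap (λ b → f b ∷ g b) bs) m ≡ coeff (map f bs) m ℚ.+ coeff (concatMap g bs) m
  coeff-interleave f g [] m = sym (ℚP.+-identityˡ _)
  coeff-interleave f g (b ∷ bs) m = begin
    coeff ((f b ∷ g b) ++ concatMap (λ b → f b ∷ g b) bs) m
      ≡⟨ coeff-∷ (f b) _ m ⟩
    cf ℚ.+ coeff (g b ++ concatMap (λ b → f b ∷ g b) bs) m
      ≡⟨ cong (cf ℚ.+_) (trans (coeff-++ (g b) _ m) (cong (coeff (g b) m ℚ.+_) (coeff-interleave f g bs m))) ⟩
    cf ℚ.+ (coeff (g b) m ℚ.+ (coeff (map f bs) m ℚ.+ coeff (concatMap g bs) m))
      ≡⟨ solve 4 (λ a b c d → a :+ (b :+ (c :+ d)) := (a :+ c) :+ (b :+ d)) refl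
           cf (coeff (g b) m) (coeff (map f bs) m) (coeff (concatMap g bs) m) ⟩
    (cf ℚ.+ coeff (map f bs) m) ℚ.+ (coeff (g b) m ℚ.+ coeff (concatMap g bs) m)
      ≡⟨ cong₂ ℚ._+_ (sym (coeff-∷ (f b) (map f bs) m)) (sym (coeff-++ (g b) _ m)) ⟩
    coeff (map f (b ∷ bs)) m ℚ.+ coeff (concatMap g (b ∷ bs)) m ∎
    where open ≡-Reasoning
          cf : ℚ
          cf = coeff (f b ∷ []) m

  concatMap-nil : ∀ {A B : Set} (bs : List A) → concatMap {B = B} (λ _ → []) bs ≡ []
  concatMap-nil [] = refl
  concatMap-nil (b ∷ bs) = concatMap-nil bs

  coeff-concatMap-swap : ∀ {A B : Set} {n} (G : A → B → ℚ × Mon n) (as : List A) (bs : List B) m →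
    coeff (concatMap (λ a → map (G a) bs) as) m ≡ coeff (concatMap (λ b → map (λ a → G a b) as) bs) m
  coeff-concatMap-swap G [] bs m = cong (λ l → coeff l m) (sym (concatMap-nil bs))
  coeff-concatMap-swap G (a ∷ as) bs m = begin
    coeff (map (G a) bs ++ concatMap (λ a → map (G a) bs) as) m
      ≡⟨ coeff-++ (map (G a) bs) _ m ⟩
    coeff (map (G a) bs) m ℚ.+ coeff (concatMap (λ a → map (G a) bs) as) m
      ≡⟨ cong (coeff (map (G a) bs) m ℚ.+_) (coeff-concatMap-swap G as bs m) ⟩
    coeff (map (G a) bs) m ℚ.+ coeff (concatMap (λ b → map (λ a → G a b) as) bs) m
      ≡⟨ sym (coeff-interleave (G a) (λ b → map (λ a → G a b) as) bs m) ⟩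
    coeff (concatMap (λ b → map (λ a' → G a' b) (a ∷ as)) bs) m ∎
    where open ≡-Reasoning

  *-comm : ∀ {n} (p q : Poly n) → (p *P q) ≈ (q *P p)
  *-comm p q m = trans (coeff-concatMap-swap termMul p q m)
    (cong (λ l → coeff l m) (ListP.concatMap-cong (λ s → ListP.map-cong (λ t → termMul-comm t s) p) q))

  *-congˡ : ∀ {n} {p p' : Poly n} (q : Poly n) → p ≈ p' → (p *P q) ≈ (p' *P q)
  *-congˡ {p = p} {p'} q e m = trans (*-comm p q m) (trans (*-congʳ q e m) (*-comm q p' m))

  -- (p·q)·r and p·(q·r) are the same list of terms, up to regrouping
  concatMap-concatMap : ∀ {A B C : Set} (f : B → List C) (g : A → List B) xs →
    concatMap f (concatMap g xs) ≡ concatMap (concatMap f ∘ g) xs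
  concatMap-concatMap f g [] = refl
  concatMap-concatMap f g (x ∷ xs) =
    trans (ListP.concatMap-++ f (g x) (concatMap g xs)) (cong (concatMap f (g x) ++_) (concatMap-concatMap f g xs))

  *-assoc : ∀ {n} (p q r : Poly n) → ((p *P q) *P r) ≈ (p *P (q *P r))
  *-assoc p q r m = cong (λ l → coeff l m) (begin
    concatMap (λ u → map (termMul u) r) (concatMap (λ t → map (termMul t) q) p)
      ≡⟨ concatMap-concatMap (λ u → map (termMul u) r) (λ t → map (termMul t) q) p ⟩
    concatMap (λ t → concatMap (λ u → map (termMul u) r) (map (termMul t) q)) p
      ≡⟨ ListP.concatMap-cong (λ t → trans (ListP.concatMap-map (λ u → map (termMul u) r) (termMul t) q)
           (ListP.concatMap-cong (λ s → trans (ListP.map-cong (λ u → termMul-assoc t s u) r) (ListP.map-∘ r)) q)) p ⟩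
    concatMap (λ t → concatMap (λ s → map (termMul t) (map (termMul s) r)) q) p
      ≡⟨ ListP.concatMap-cong (λ t → sym (ListP.map-concatMap (termMul t) (λ s → map (termMul s) r) q)) p ⟩
    concatMap (λ t → map (termMul t) (concatMap (λ s → map (termMul s) r) q)) p ∎)
    where open ≡-Reasoning

  *-distribʳ : ∀ {n} (p q r : Poly n) → ((q +P r) *P p) ≈ ((q *P p) +P (r *P p))
  *-distribʳ p q r m = cong (λ l → coeff l m) (ListP.concatMap-++ _ q r)

  *-distribˡ : ∀ {n} (p q r : Poly n) → (p *P (q +P r)) ≈ ((p *P q) +P (p *P r))
  *-distribˡ p q r m = trans (*-comm p (q +P r) m) (trans (*-distribʳ p q r m)
    (trans (coeff-++ (q *P p) _ m) (trans (cong₂ ℚ._+_ (*-comm q p m) (*-comm r p m)) (sym (coeff-++ (p *P q) _ m)))))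

  *-identityˡ : ∀ {n} (p : Poly n) → (1P *P p) ≈ p
  *-identityˡ {n} p m = cong (λ l → coeff l m) (trans (ListP.++-identityʳ _) (trans (ListP.map-cong unitTerm p) (ListP.map-id p)))
    where unitTerm : ∀ (s : ℚ × Mon n) → termMul (1ℚ , Vec.replicate n 0) s ≡ s
          unitTerm (c , x) = cong₂ _,_ (ℚP.*-identityˡ c) (VecP.zipWith-identityˡ (λ _ → refl) x)

  +-comm : ∀ {n} (p q : Poly n) → (p +P q) ≈ (q +P p)
  +-comm p q m = trans (coeff-++ p q m) (trans (ℚP.+-comm (coeff p m) (coeff q m)) (sym (coeff-++ q p m)))

  +-cong : ∀ {n} {p p' q q' : Poly n} → p ≈ p' → q ≈ q' → (p +P q) ≈ (p' +P q')
  +-cong {p = p} {p'} {q} {q'} e f m = trans (coeff-++ p q m) (trans (cong₂ ℚ._+_ (e m) (f m)) (sym (coeff-++ p' q' m)))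

  neg-cong : ∀ {n} {p p' : Poly n} → p ≈ p' → negP p ≈ negP p'
  neg-cong {p = p} {p'} e m = trans (coeff-neg p m) (trans (cong ℚ.-_ (e m)) (sym (coeff-neg p' m)))

  neg-inverseˡ : ∀ {n} (p : Poly n) → (negP p +P p) ≈ 0P
  neg-inverseˡ p m = trans (coeff-++ (negP p) p m) (trans (cong (ℚ._+ coeff p m) (coeff-neg p m)) (ℚP.+-inverseˡ (coeff p m)))

  neg-inverseʳ : ∀ {n} (p : Poly n) → (p +P negP p) ≈ 0P
  neg-inverseʳ p m = trans (+-comm p (negP p) m) (neg-inverseˡ p m)

  -- Equality of coefficients wrapped in a record, so that the implicit
  -- arguments of the ring laws can be inferred from it.
  record _≋_ {n} (p q : Poly n) : Set where
    constructor mk≋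
    field get : p ≈ q
  open _≋_ public

  isCommutativeRing : ∀ n → IsCommutativeRing {A = Poly n} _≋_ _+P_ _*P_ negP 0P 1P
  isCommutativeRing n = record
    { isRing = record
      { +-isAbelianGroup = record
        { isGroup = record
          { isMonoid = record
            { isSemigroup = record
              { isMagma = record
                { isEquivalence = record
                  { refl  = mk≋ (λ m → refl)
                  ; sym   = λ e → mk≋ (λ m → sym (get e m))
                  ; trans = λ e f → mk≋ (λ m → trans (get e m) (get f m)) }
                ; ∙-cong = λ {x} {y} {u} {v} e f → mk≋ (+-cong {p = x} {y} {u} {v} (get e) (get f)) }
              ; assoc = λ p q r → mk≋ (λ m → cong (λ l → coeff l m) (ListP.++-assoc p q r)) }
            ; identity = (λ p → mk≋ (λ m → refl)) , (λ p → mk≋ (λ m → cong (λ l → coeff l m) (ListP.++-identityʳ p))) }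
          ; inverse = (λ p → mk≋ (neg-inverseˡ p)) , (λ p → mk≋ (neg-inverseʳ p))
          ; ⁻¹-cong = λ {x} {y} e → mk≋ (neg-cong {p = x} {y} (get e)) }
        ; comm = λ p q → mk≋ (+-comm p q) }
      ; *-cong = λ {p} {p'} {q} {q'} e f → mk≋ (λ m → trans (*-congˡ {p = p} {p'} q (get e) m) (*-congʳ p' {q} {q'} (get f) m))
      ; *-assoc = λ p q r → mk≋ (*-assoc p q r)
      ; *-identity = (λ p → mk≋ (*-identityˡ p)) , (λ p → mk≋ (λ m → trans (*-comm p 1P m) (*-identityˡ p m)))
      ; distrib = (λ p q r → mk≋ (*-distribˡ p q r)) , (λ p q r → mk≋ (*-distribʳ p q r)) }
    ; *-comm = λ p q → mk≋ (*-comm p q) }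

  -- The ring operations are exported as opaque names: ring-level reasoning
  -- (determinants, sums) then never unfolds the list representation, and the
  -- equations ⊕-def, ⊗-def, ⊖-def recover it when a term is inspected.
  opaque
    _⊕_ : ∀ {n} → Poly n → Poly n → Poly n
    _⊕_ = _+P_
    _⊗_ : ∀ {n} → Poly n → Poly n → Poly n
    _⊗_ = _*P_
    ⊖ : ∀ {n} → Poly n → Poly n
    ⊖ = negP

  opaque
    unfolding _⊕_ _⊗_ ⊖
    isCommutativeRing′ : ∀ n → IsCommutativeRing {A = Poly n} _≋_ _⊕_ _⊗_ ⊖ 0P 1P
    isCommutativeRing′ = isCommutativeRing
    ⊕-def : ∀ {n} (p q : Poly n) → p ⊕ q ≡ p +P q
    ⊕-def p q = refl
    ⊗-def : ∀ {n} (p q : Poly n) → p ⊗ q ≡ p *P q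
    ⊗-def p q = refl
    ⊖-def : ∀ {n} (p : Poly n) → ⊖ p ≡ negP p
    ⊖-def p = refl

  PolyRing : ℕ → CommutativeRing _ _
  PolyRing n = record { isCommutativeRing = isCommutativeRing′ n }

  +P≋⊕ : ∀ {n} (p q : Poly n) → (p +P q) ≋ (p ⊕ q)
  +P≋⊕ p q = mk≋ (λ m → cong (λ l → coeff l m) (sym (⊕-def p q)))

  *P≋⊗ : ∀ {n} (p q : Poly n) → (p *P q) ≋ (p ⊗ q)
  *P≋⊗ p q = mk≋ (λ m → cong (λ l → coeff l m) (sym (⊗-def p q)))

-- A t × t matrix is a function M r i (row r : Fin t, column i : ℕ; only
-- the columns i < t are read).  The determinant is defined by Laplace
-- expansion along column 0.  We show that it is alternating in the first
-- two columns, hence vanishes when column 0 repeats a later column (if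
-- 2x = 0 forces x = 0), and deduce: if a fixed combination of the columns
-- with coefficient 1 on column 0 lies in an ideal for every row, then so
-- does the determinant.
module Determinants {c ℓ} (R : CommutativeRing c ℓ) where

  open import Data.Nat using (ℕ; zero; suc; _≤_; _<_; s≤s; z≤n)
  open import Data.Fin using (Fin; zero; suc; toℕ; punchIn)
  open import Data.Fin.Properties using (toℕ<n)
  open import Function using (_∘_)
  open CommutativeRing R hiding (zero)
  open import Algebra.Properties.Ring ring
  open import Algebra.Properties.Semiring.Sum semiring
  open import Relation.Binary.Reasoning.Setoid setoid
  import Algebra.Solver.CommutativeMonoid as CMS
  module MS = CMS *-commutativeMonoid
  import Relation.Binary.PropositionalEquality as P

  sign : ℕ → Carrier
  sign zero    = 1#
  sign (suc k) = - sign k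

  det : ∀ t → (Fin t → ℕ → Carrier) → Carrier
  det zero    M = 1#
  det (suc t) M = ∑[ r < suc t ] (sign (toℕ r) * (M r 0 * det t (λ r' i → M (punchIn r r') (suc i))))

  det-cong : ∀ t {M M' : Fin t → ℕ → Carrier} → (∀ r i → M r i ≈ M' r i) → det t M ≈ det t M'
  det-cong zero    e = refl
  det-cong (suc t) e = sum-cong-≋ {suc t} (λ r →
    *-congˡ {sign (toℕ r)} (*-cong (e r 0) (det-cong t (λ r' i → e (punchIn r r') (suc i)))))

  det-cong-≡ : ∀ t {M M' : Fin t → ℕ → Carrier} → (∀ r i → M r i P.≡ M' r i) → det t M P.≡ det t M'
  det-cong-≡ zero    e = P.refl
  det-cong-≡ (suc t) e = sum-cong-≗ {suc t} (λ r →
    P.cong₂ (λ x y → sign (toℕ r) * (x * y)) (e r 0) (det-cong-≡ t (λ r' i → e (punchIn r r') (suc i))))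

  withFirstColumn : ∀ {t} → (Fin t → ℕ → Carrier) → ℕ → Fin t → ℕ → Carrier
  withFirstColumn M j r zero    = M r j
  withFirstColumn M j r (suc i) = M r (suc i)

  swapFirstTwo : ℕ → ℕ
  swapFirstTwo zero          = 1
  swapFirstTwo (suc zero)    = 0
  swapFirstTwo (suc (suc i)) = suc (suc i)

  -- rankWithout x y: the position of y once x is removed (a total punchOut);
  -- it inverts punchIn x, and removing x then punchIn x r amounts to
  -- removing punchIn x r then x.
  rankWithout : ∀ {t} → Fin (suc (suc t)) → Fin (suc (suc t)) → Fin (suc t)
  rankWithout {t}     zero    zero    = zero
  rankWithout {t}     zero    (suc y) = y
  rankWithout {t}     (suc x) zero    = zero
  rankWithout {zero}  (suc x) (suc y) = zero
  rankWithout {suc t} (suc x) (suc y) = suc (rankWithout x y)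

  rankWithout-punchIn : ∀ {t} (x : Fin (suc (suc t))) (r : Fin (suc t)) → rankWithout x (punchIn x r) P.≡ r
  rankWithout-punchIn {t}     zero    r       = P.refl
  rankWithout-punchIn {t}     (suc x) zero    = P.refl
  rankWithout-punchIn {suc t} (suc x) (suc r) = P.cong suc (rankWithout-punchIn x r)

  punchIn-punchIn-rankWithout : ∀ {t} (x : Fin (suc (suc t))) (r : Fin (suc t)) (z : Fin t) →
    punchIn (punchIn x r) (punchIn (rankWithout (punchIn x r) x) z) P.≡ punchIn x (punchIn r z)
  punchIn-punchIn-rankWithout {t}     zero    r       z       = P.refl
  punchIn-punchIn-rankWithout {t}     (suc x) zero    z       = P.refl
  punchIn-punchIn-rankWithout {suc t} (suc x) (suc r) zero    = P.refl
  punchIn-punchIn-rankWithout {suc t} (suc x) (suc r) (suc z) = P.cong suc (punchIn-punchIn-rankWithout x r z)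

  neg*neg : ∀ a b → (- a) * (- b) ≈ a * b
  neg*neg a b = begin
    (- a) * (- b) ≈⟨ -‿distribˡ-* a (- b) ⟨
    - (a * - b)   ≈⟨ -‿cong (-‿distribʳ-* a b) ⟨
    - - (a * b)   ≈⟨ -‿involutive (a * b) ⟩
    a * b         ∎

  -- the two orders of deleting two rows x and y = punchIn x r differ by a sign
  sign-rankWithout : ∀ {t} (x : Fin (suc (suc t))) (r : Fin (suc t)) →
    sign (toℕ (punchIn x r)) * sign (toℕ (rankWithout (punchIn x r) x)) ≈ - (sign (toℕ x) * sign (toℕ r))
  sign-rankWithout {t} zero r = begin
    (- sign (toℕ r)) * 1#     ≈⟨ *-identityʳ _ ⟩
    - sign (toℕ r)            ≈⟨ -‿cong (*-identityˡ _) ⟨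
    - (1# * sign (toℕ r))     ∎
  sign-rankWithout {t} (suc x) zero = begin
    1# * sign (toℕ x)         ≈⟨ *-identityˡ _ ⟩
    sign (toℕ x)              ≈⟨ -‿involutive _ ⟨
    - - sign (toℕ x)          ≈⟨ -‿cong (*-identityʳ _) ⟨
    - ((- sign (toℕ x)) * 1#) ∎
  sign-rankWithout {suc t} (suc x) (suc r) = begin
    (- sign (toℕ (punchIn x r))) * (- sign (toℕ (rankWithout (punchIn x r) x))) ≈⟨ neg*neg _ _ ⟩
    sign (toℕ (punchIn x r)) * sign (toℕ (rankWithout (punchIn x r) x))         ≈⟨ sign-rankWithout x r ⟩
    - (sign (toℕ x) * sign (toℕ r))                                             ≈⟨ -‿cong (neg*neg _ _) ⟨
    - ((- sign (toℕ x)) * (- sign (toℕ r)))                                     ∎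

  sum-neg : ∀ {n} (f : Fin n → Carrier) → sum (λ i → - f i) ≈ - sum f
  sum-neg {zero}  f = sym -0#≈0#
  sum-neg {suc n} f = begin
    - f zero + sum (λ i → - f (suc i)) ≈⟨ +-congˡ (sum-neg (f ∘ suc)) ⟩
    - f zero + - sum (f ∘ suc)         ≈⟨ +-comm _ _ ⟩
    - sum (f ∘ suc) + - f zero         ≈⟨ -‿anti-homo-+ (f zero) (sum (f ∘ suc)) ⟨
    - (f zero + sum (f ∘ suc))         ∎

  sum-≈0 : ∀ {n} (f : Fin n → Carrier) → (∀ i → f i ≈ 0#) → sum f ≈ 0#
  sum-≈0 {zero}  f e = refl
  sum-≈0 {suc n} f e = trans (+-cong (e zero) (sum-≈0 (f ∘ suc) (e ∘ suc))) (+-identityˡ 0#)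

  sum-offDiagonal+diagonal : ∀ {m} (H : Fin (suc m) → Fin (suc m) → Carrier) →
    sum (λ x → sum (λ r → H x (punchIn x r))) + sum (λ x → H x x) ≈ sum (λ x → sum (λ y → H x y))
  sum-offDiagonal+diagonal H = begin
    sum (λ x → sum (λ r → H x (punchIn x r))) + sum (λ x → H x x) ≈⟨ +-comm _ _ ⟩
    sum (λ x → H x x) + sum (λ x → sum (λ r → H x (punchIn x r))) ≈⟨ ∑-distrib-+ (λ x → H x x) (λ x → sum (λ r → H x (punchIn x r))) ⟨
    sum (λ x → H x x + sum (λ r → H x (punchIn x r)))             ≈⟨ sum-cong-≋ (λ x → sum-remove {i = x} (H x)) ⟨
    sum (λ x → sum (λ y → H x y))                                 ∎

  minor2 : ∀ t → (Fin (suc (suc t)) → ℕ → Carrier) → Fin (suc (suc t)) → Fin (suc t) → Carrier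
  minor2 t N x r = det t (λ r'' i → N (punchIn x (punchIn r r'')) (suc (suc i)))

  det-expand2 : ∀ t (N : Fin (suc (suc t)) → ℕ → Carrier) →
    det (suc (suc t)) N ≈
      sum (λ x → sum (λ r → (sign (toℕ x) * sign (toℕ r)) * ((N x 0 * N (punchIn x r) 1) * minor2 t N x r)))
  det-expand2 t N = sum-cong-≋ {suc (suc t)} λ x → begin
    sign (toℕ x) * (N x 0 * sum (λ r → sign (toℕ r) * (N (punchIn x r) 1 * minor2 t N x r)))
      ≈⟨ *-congˡ {sign (toℕ x)} (*-distribˡ-sum {suc t} (N x 0) (λ r → sign (toℕ r) * (N (punchIn x r) 1 * minor2 t N x r))) ⟩
    sign (toℕ x) * sum (λ r → N x 0 * (sign (toℕ r) * (N (punchIn x r) 1 * minor2 t N x r)))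
      ≈⟨ *-distribˡ-sum {suc t} (sign (toℕ x)) (λ r → N x 0 * (sign (toℕ r) * (N (punchIn x r) 1 * minor2 t N x r))) ⟩
    sum (λ r → sign (toℕ x) * (N x 0 * (sign (toℕ r) * (N (punchIn x r) 1 * minor2 t N x r))))
      ≈⟨ sum-cong-≋ {suc t} (λ r → MS.solve 5
           (λ a b c d e → a MS.⊕ (b MS.⊕ (c MS.⊕ (d MS.⊕ e))) MS.⊜ (a MS.⊕ c) MS.⊕ ((b MS.⊕ d) MS.⊕ e)) refl
           (sign (toℕ x)) (N x 0) (sign (toℕ r)) (N (punchIn x r) 1) (minor2 t N x r)) ⟩
    sum (λ r → (sign (toℕ x) * sign (toℕ r)) * ((N x 0 * N (punchIn x r) 1) * minor2 t N x r)) ∎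

  -- Swapping the first two columns negates the determinant: in the
  -- two-column expansion, the term for the pair of rows (x , y) of the
  -- swapped matrix is minus the term for (y , x) of the original one.
  module _ (t : ℕ) (M : Fin (suc (suc t)) → ℕ → Carrier) where
    private
      pairTerm : Fin (suc (suc t)) → Fin (suc (suc t)) → Carrier
      pairTerm x y = (sign (toℕ x) * sign (toℕ (rankWithout x y))) *
        ((M x 0 * M y 1) * det t (λ r'' i → M (punchIn x (punchIn (rankWithout x y) r'')) (suc (suc i))))

      pairTerm-original : ∀ x r → pairTerm x (punchIn x r) ≈
        (sign (toℕ x) * sign (toℕ r)) * ((M x 0 * M (punchIn x r) 1) * minor2 t M x r)
      pairTerm-original x r = reflexive (P.cong (λ z → (sign (toℕ x) * sign (toℕ z)) *
        ((M x 0 * M (punchIn x r) 1) * det t (λ r'' i → M (punchIn x (punchIn z r'')) (suc (suc i)))))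
        (rankWithout-punchIn x r))

      pairTerm-swapped : ∀ x r → (sign (toℕ x) * sign (toℕ r)) * ((M x 1 * M (punchIn x r) 0) * minor2 t M x r)
                                 ≈ - pairTerm (punchIn x r) x
      pairTerm-swapped x r = begin
        s * ((M x 1 * M y 0) * minor2 t M x r)          ≈⟨ *-congˡ {s} (*-congʳ (*-comm _ _)) ⟩
        s * ((M y 0 * M x 1) * minor2 t M x r)          ≈⟨ -‿involutive _ ⟨
        - - (s * ((M y 0 * M x 1) * minor2 t M x r))    ≈⟨ -‿cong (-‿distribˡ-* _ _) ⟩
        - ((- s) * ((M y 0 * M x 1) * minor2 t M x r))  ≈⟨ -‿cong (*-cong (sym (sign-rankWithout x r))
             (*-congˡ {M y 0 * M x 1} (det-cong t (λ r'' i →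
               reflexive (P.cong (λ z → M z (suc (suc i))) (P.sym (punchIn-punchIn-rankWithout x r r''))))))) ⟩
        - pairTerm y x                                  ∎
        where y : Fin (suc (suc t))
              y = punchIn x r
              s : Carrier
              s = sign (toℕ x) * sign (toℕ r)

      offDiagonal offDiagonalᵀ diagonal : Carrier
      offDiagonal  = sum (λ x → sum (λ r → pairTerm x (punchIn x r)))
      offDiagonalᵀ = sum (λ x → sum (λ r → pairTerm (punchIn x r) x))
      diagonal     = sum (λ x → pairTerm x x)

      offDiagonal-symmetric : offDiagonalᵀ ≈ offDiagonal
      offDiagonal-symmetric = +-cancelʳ diagonal offDiagonalᵀ offDiagonal (begin
        offDiagonalᵀ + diagonal                    ≈⟨ sum-offDiagonal+diagonal (λ x y → pairTerm y x) ⟩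
        sum (λ x → sum (λ y → pairTerm y x))       ≈⟨ ∑-comm (λ y x → pairTerm y x) ⟨
        sum (λ x → sum (λ y → pairTerm x y))       ≈⟨ sum-offDiagonal+diagonal pairTerm ⟨
        offDiagonal + diagonal                     ∎)

    det-swapFirstTwo : det (suc (suc t)) (λ r i → M r (swapFirstTwo i)) ≈ - det (suc (suc t)) M
    det-swapFirstTwo = begin
      det (suc (suc t)) (λ r i → M r (swapFirstTwo i))
        ≈⟨ det-expand2 t (λ r i → M r (swapFirstTwo i)) ⟩
      sum (λ x → sum (λ r → (sign (toℕ x) * sign (toℕ r)) * ((M x 1 * M (punchIn x r) 0) * minor2 t M x r)))
        ≈⟨ sum-cong-≋ {suc (suc t)} (λ x → sum-cong-≋ {suc t} (λ r → pairTerm-swapped x r)) ⟩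
      sum (λ x → sum (λ r → - pairTerm (punchIn x r) x))
        ≈⟨ sum-cong-≋ {suc (suc t)} (λ x → sum-neg (λ r → pairTerm (punchIn x r) x)) ⟩
      sum (λ x → - sum (λ r → pairTerm (punchIn x r) x))
        ≈⟨ sum-neg (λ x → sum (λ r → pairTerm (punchIn x r) x)) ⟩
      - offDiagonalᵀ
        ≈⟨ -‿cong offDiagonal-symmetric ⟩
      - offDiagonal
        ≈⟨ -‿cong (sum-cong-≋ {suc (suc t)} (λ x → sum-cong-≋ {suc t} (λ r → pairTerm-original x r))) ⟩
      - sum (λ x → sum (λ r → (sign (toℕ x) * sign (toℕ r)) * ((M x 0 * M (punchIn x r) 1) * minor2 t M x r)))
        ≈⟨ -‿cong (det-expand2 t M) ⟨
      - det (suc (suc t)) M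
        ∎

  module Alternating (cancel2 : ∀ x → x + x ≈ 0# → x ≈ 0#) where

    det-repeatedColumn : ∀ t (M : Fin t → ℕ → Carrier) j → 1 ≤ j → j < t → det t (withFirstColumn M j) ≈ 0#
    det-repeatedColumn (suc zero) M (suc j) (s≤s _) (s≤s ())
    det-repeatedColumn (suc (suc t)) M (suc zero) _ _ = cancel2 X (begin
        X + X                                                  ≈⟨ +-congʳ (det-cong (suc (suc t)) swapInvariant) ⟩
        det (suc (suc t)) (λ r i → M′ r (swapFirstTwo i)) + X ≈⟨ +-congʳ (det-swapFirstTwo t M′) ⟩
        - X + X                                                ≈⟨ -‿inverseˡ X ⟩
        0#                                                     ∎)
      where
      M′ : Fin (suc (suc t)) → ℕ → Carrier
      M′ = withFirstColumn M 1
      X : Carrier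
      X = det (suc (suc t)) M′
      swapInvariant : ∀ r i → M′ r i ≈ M′ r (swapFirstTwo i)
      swapInvariant r zero          = refl
      swapInvariant r (suc zero)    = refl
      swapInvariant r (suc (suc i)) = refl
    det-repeatedColumn (suc (suc t)) M (suc (suc j)) _ (s≤s j<) = begin
        X                                                  ≈⟨ -‿involutive X ⟨
        - - X                                              ≈⟨ -‿cong (det-swapFirstTwo t M′) ⟨
        - det (suc (suc t)) (λ r i → M′ r (swapFirstTwo i)) ≈⟨ -‿cong (sum-≈0 _ (λ r →
             trans (*-congˡ {sign (toℕ r)} (*-congˡ {M r 1} (minor≈0 r)))
                   (trans (*-congˡ {sign (toℕ r)} (zeroʳ _)) (zeroʳ _)))) ⟩
        - 0#                                               ≈⟨ -0#≈0# ⟩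
        0#                                                 ∎
      where
      M′ : Fin (suc (suc t)) → ℕ → Carrier
      M′ = withFirstColumn M (suc (suc j))
      X : Carrier
      X = det (suc (suc t)) M′
      -- after the swap, every minor of column 0 again has a repeated column
      minor≈0 : ∀ r → det (suc t) (λ r' i → M′ (punchIn r r') (swapFirstTwo (suc i))) ≈ 0#
      minor≈0 r = trans (det-cong (suc t) same)
                        (det-repeatedColumn (suc t) (λ r' i → M (punchIn r r') (suc i)) (suc j) (s≤s z≤n) j<)
        where
        same : ∀ r' i → M′ (punchIn r r') (swapFirstTwo (suc i)) ≈ withFirstColumn (λ r' i → M (punchIn r r') (suc i)) (suc j) r' i
        same r' zero    = refl
        same r' (suc i) = refl

    -- Cramer's rule in ideal form: if for each row r the combination
    -- Σⱼ E j · M r j (with E 0 = 1) lies in the ideal I, so does det M,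
    -- because Σᵣ cofactorᵣ · (Σⱼ E j · M r j) = Σⱼ E j · det (column 0 := column j).
    module Cramer (I : Carrier → Set) (I-resp : ∀ {x y} → x ≈ y → I x → I y)
                  (I-0 : I 0#) (I-+ : ∀ {x y} → I x → I y → I (x + y)) (I-* : ∀ a {x} → I x → I (a * x)) where

      I-sum : ∀ {n} (f : Fin n → Carrier) → (∀ i → I (f i)) → I (sum f)
      I-sum {zero}  f h = I-0
      I-sum {suc n} f h = I-+ (h zero) (I-sum (f ∘ suc) (h ∘ suc))

      cramer : ∀ t (M : Fin (suc t) → ℕ → Carrier) (E : ℕ → Carrier) → E 0 ≈ 1# →
        (∀ r → I (sum {suc t} (λ j → E (toℕ j) * M r (toℕ j)))) → I (det (suc t) M)
      cramer t M E E0≈1 rowsInI = I-resp expansion (I-sum _ (λ r → I-* (sign (toℕ r) * minor r) (rowsInI r)))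
        where
        minor : Fin (suc t) → Carrier
        minor r = det t (λ r' i → M (punchIn r r') (suc i))
        -- det of M with column 0 replaced by column j, expanded along column 0
        detWith : Fin (suc t) → Carrier
        detWith j = sum {suc t} (λ r → sign (toℕ r) * (M r (toℕ j) * minor r))
        expansion : sum {suc t} (λ r → (sign (toℕ r) * minor r) * sum {suc t} (λ j → E (toℕ j) * M r (toℕ j))) ≈ det (suc t) M
        expansion = begin
          sum {suc t} (λ r → (sign (toℕ r) * minor r) * sum {suc t} (λ j → E (toℕ j) * M r (toℕ j)))
            ≈⟨ sum-cong-≋ {suc t} (λ r → *-distribˡ-sum {suc t} (sign (toℕ r) * minor r) (λ j → E (toℕ j) * M r (toℕ j))) ⟩
          sum {suc t} (λ r → sum {suc t} (λ j → (sign (toℕ r) * minor r) * (E (toℕ j) * M r (toℕ j))))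
            ≈⟨ sum-cong-≋ {suc t} (λ r → sum-cong-≋ {suc t} (λ j →
                 MS.solve 4 (λ a b c d → (a MS.⊕ b) MS.⊕ (c MS.⊕ d) MS.⊜ c MS.⊕ (a MS.⊕ (d MS.⊕ b))) refl
                   (sign (toℕ r)) (minor r) (E (toℕ j)) (M r (toℕ j)))) ⟩
          sum {suc t} (λ r → sum {suc t} (λ j → E (toℕ j) * (sign (toℕ r) * (M r (toℕ j) * minor r))))
            ≈⟨ ∑-comm {suc t} {suc t} (λ r j → E (toℕ j) * (sign (toℕ r) * (M r (toℕ j) * minor r))) ⟩
          sum {suc t} (λ j → sum {suc t} (λ r → E (toℕ j) * (sign (toℕ r) * (M r (toℕ j) * minor r))))
            ≈⟨ sum-cong-≋ {suc t} (λ j → *-distribˡ-sum {suc t} (E (toℕ j)) (λ r → sign (toℕ r) * (M r (toℕ j) * minor r))) ⟨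
          sum {suc t} (λ j → E (toℕ j) * detWith j)
            ≈⟨ +-cong (trans (*-congʳ E0≈1) (*-identityˡ _))
                 (sum-≈0 {t} (λ j → E (suc (toℕ j)) * detWith (suc j)) (λ j →
                   trans (*-congˡ {E (suc (toℕ j))} (det-repeatedColumn (suc t) M (suc (toℕ j)) (s≤s z≤n) (s≤s (toℕ<n j))))
                         (zeroʳ _))) ⟩
          det (suc t) M + 0#
            ≈⟨ +-identityʳ _ ⟩
          det (suc t) M
            ∎

-- Sums over an initial segment of ℕ and convolution of sequences over a
-- commutative ring; a sequence a stands for the power series Σ aⱼ zʲ, so
-- that convolution is the product of series and shiftRight a is z · a.
module Convolution {c ℓ} (R : CommutativeRing c ℓ) where

  open import Data.Nat using (ℕ; zero; suc; _<_; s≤s; z≤n; _∸_)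
  import Data.Nat.Properties as ℕP
  open import Data.Fin using (toℕ)
  open import Function using (_∘_)
  open CommutativeRing R hiding (zero)
  open import Algebra.Properties.Semiring.Sum semiring using (sum)
  open import Relation.Binary.Reasoning.Setoid setoid
  import Relation.Binary.PropositionalEquality as P
  import Algebra.Solver.CommutativeMonoid as CMS
  module AS = CMS +-commutativeMonoid

  sumTo : ℕ → (ℕ → Carrier) → Carrier
  sumTo zero    f = 0#
  sumTo (suc N) f = f 0 + sumTo N (f ∘ suc)

  sumTo-cong : ∀ N (f g : ℕ → Carrier) → (∀ j → j < N → f j ≈ g j) → sumTo N f ≈ sumTo N g
  sumTo-cong zero    f g e = refl
  sumTo-cong (suc N) f g e = +-cong (e 0 (s≤s z≤n)) (sumTo-cong N (f ∘ suc) (g ∘ suc) (λ j j< → e (suc j) (s≤s j<)))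

  sumTo-+ : ∀ N (f g : ℕ → Carrier) → sumTo N (λ j → f j + g j) ≈ sumTo N f + sumTo N g
  sumTo-+ zero    f g = sym (+-identityˡ 0#)
  sumTo-+ (suc N) f g = begin
    (f 0 + g 0) + sumTo N (λ j → f (suc j) + g (suc j))   ≈⟨ +-congˡ (sumTo-+ N (f ∘ suc) (g ∘ suc)) ⟩
    (f 0 + g 0) + (sumTo N (f ∘ suc) + sumTo N (g ∘ suc))
      ≈⟨ AS.solve 4 (λ a b x y → (a AS.⊕ b) AS.⊕ (x AS.⊕ y) AS.⊜ (a AS.⊕ x) AS.⊕ (b AS.⊕ y)) refl
           (f 0) (g 0) (sumTo N (f ∘ suc)) (sumTo N (g ∘ suc)) ⟩
    (f 0 + sumTo N (f ∘ suc)) + (g 0 + sumTo N (g ∘ suc)) ∎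

  sumTo-* : ∀ N (t : Carrier) (f : ℕ → Carrier) → sumTo N (λ j → t * f j) ≈ t * sumTo N f
  sumTo-* zero    t f = sym (zeroʳ t)
  sumTo-* (suc N) t f = trans (+-congˡ (sumTo-* N t (f ∘ suc))) (sym (distribˡ t (f 0) _))

  sumTo-last : ∀ N (f : ℕ → Carrier) → sumTo (suc N) f ≈ sumTo N f + f N
  sumTo-last zero    f = trans (+-identityʳ (f 0)) (sym (+-identityˡ (f 0)))
  sumTo-last (suc N) f = trans (+-congˡ (sumTo-last N (f ∘ suc))) (sym (+-assoc _ _ _))

  sum≈sumTo : ∀ N (f : ℕ → Carrier) → sum {N} (λ j → f (toℕ j)) ≈ sumTo N f
  sum≈sumTo zero    f = refl
  sum≈sumTo (suc N) f = +-congˡ (sum≈sumTo N (f ∘ suc))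

  conv : (ℕ → Carrier) → (ℕ → Carrier) → ℕ → Carrier
  conv a b k = sumTo (suc k) (λ j → a j * b (k ∸ j))

  shiftRight : (ℕ → Carrier) → ℕ → Carrier
  shiftRight a zero    = 0#
  shiftRight a (suc j) = a j

  δ : ℕ → Carrier
  δ zero    = 1#
  δ (suc _) = 0#

  conv-congˡ : ∀ {a a'} b k → (∀ j → a j ≈ a' j) → conv a b k ≈ conv a' b k
  conv-congˡ {a} {a'} b k e = sumTo-cong (suc k) (λ j → a j * b (k ∸ j)) (λ j → a' j * b (k ∸ j)) (λ j _ → *-congʳ (e j))

  conv-congʳ : ∀ a {b b'} k → (∀ j → b j ≈ b' j) → conv a b k ≈ conv a b' k
  conv-congʳ a {b} {b'} k e = sumTo-cong (suc k) (λ j → a j * b (k ∸ j)) (λ j → a j * b' (k ∸ j)) (λ j _ → *-congˡ (e (k ∸ j)))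

  conv-+ˡ : ∀ a a' b k → conv (λ j → a j + a' j) b k ≈ conv a b k + conv a' b k
  conv-+ˡ a a' b k = trans (sumTo-cong (suc k) _ (λ j → a j * b (k ∸ j) + a' j * b (k ∸ j)) (λ j _ → distribʳ _ _ _))
                           (sumTo-+ (suc k) (λ j → a j * b (k ∸ j)) (λ j → a' j * b (k ∸ j)))

  conv-+ʳ : ∀ a b b' k → conv a (λ j → b j + b' j) k ≈ conv a b k + conv a b' k
  conv-+ʳ a b b' k = trans (sumTo-cong (suc k) _ (λ j → a j * b (k ∸ j) + a j * b' (k ∸ j)) (λ j _ → distribˡ _ _ _))
                           (sumTo-+ (suc k) (λ j → a j * b (k ∸ j)) (λ j → a j * b' (k ∸ j)))

  conv-*ˡ : ∀ t a b k → conv (λ j → t * a j) b k ≈ t * conv a b k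
  conv-*ˡ t a b k = trans (sumTo-cong (suc k) _ (λ j → t * (a j * b (k ∸ j))) (λ j _ → *-assoc _ _ _))
                          (sumTo-* (suc k) t (λ j → a j * b (k ∸ j)))

  conv-*ʳ : ∀ t a b k → conv a (λ j → t * b j) k ≈ t * conv a b k
  conv-*ʳ t a b k = trans (sumTo-cong (suc k) _ (λ j → t * (a j * b (k ∸ j)))
                            (λ j _ → trans (sym (*-assoc _ _ _)) (trans (*-congʳ (*-comm _ _)) (*-assoc _ _ _))))
                          (sumTo-* (suc k) t (λ j → a j * b (k ∸ j)))

  conv-shiftˡ-0 : ∀ a b → conv (shiftRight a) b 0 ≈ 0#
  conv-shiftˡ-0 a b = trans (+-identityʳ _) (zeroˡ _)

  conv-shiftˡ : ∀ a b k → conv (shiftRight a) b (suc k) ≈ conv a b k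
  conv-shiftˡ a b k = trans (+-congʳ (zeroˡ _)) (+-identityˡ _)

  conv-shiftʳ-0 : ∀ a b → conv a (shiftRight b) 0 ≈ 0#
  conv-shiftʳ-0 a b = trans (+-identityʳ _) (zeroʳ _)

  conv-shiftʳ : ∀ a b k → conv a (shiftRight b) (suc k) ≈ conv a b k
  conv-shiftʳ a b k = begin
    sumTo (suc (suc k)) (λ j → a j * shiftRight b (suc k ∸ j))
      ≈⟨ sumTo-last (suc k) (λ j → a j * shiftRight b (suc k ∸ j)) ⟩
    sumTo (suc k) (λ j → a j * shiftRight b (suc k ∸ j)) + a (suc k) * shiftRight b (suc k ∸ suc k)
      ≈⟨ +-cong (sumTo-cong (suc k) _ (λ j → a j * b (k ∸ j))
                   (λ j j< → *-congˡ (reflexive (P.cong (shiftRight b) (ℕP.+-∸-assoc 1 (ℕP.≤-pred j<))))))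
                (trans (*-congˡ (reflexive (P.cong (shiftRight b) (ℕP.n∸n≡0 k)))) (zeroʳ _)) ⟩
    conv a b k + 0#
      ≈⟨ +-identityʳ _ ⟩
    conv a b k ∎

  conv-δ : ∀ a k → conv a δ k ≈ a k
  conv-δ a zero    = trans (+-identityʳ _) (*-identityʳ _)
  conv-δ a (suc k) = begin
    a 0 * 0# + conv (a ∘ suc) δ k ≈⟨ +-cong (zeroʳ _) (conv-δ (a ∘ suc) k) ⟩
    0# + a (suc k)                ≈⟨ +-identityˡ _ ⟩
    a (suc k)                     ∎

-- Writing E_Z(z) = Σⱼ (-1)ʲ eⱼ(Z) zʲ
-- = Π_{t ∈ Z} (1 - x_t z) and H_T(z) = Σₘ hₘ(T) zᵐ = Π_{t ∈ T} 1/(1 - x_t z),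
-- we prove  E_{T++X} · H_T = E_X  and  E_Q · H_{P++Q} = H_P  coefficientwise,
-- by induction on the lists from the recursions
-- E_{t∷Z} = E_Z - x_t z E_Z  and  H_{t∷T} = H_T + x_t z H_{t∷T}.
module SymmetricFunctionIdentities (n : ℕ) where

  open import Defs hiding (_≈_)
  open PolynomialRing using (PolyRing; +P≋⊕; *P≋⊗)
  open import Data.Nat using (zero; suc; _<_; s≤s)
  import Data.Nat.Properties as ℕP
  open import Data.Fin using (Fin)
  open import Data.List using (List; []; _∷_; _++_; length)
  import Data.List.Properties as ListP
  import Relation.Binary.PropositionalEquality as P
  import Algebra.Solver.CommutativeMonoid as CMS

  open CommutativeRing (PolyRing n) hiding (zero)
  open import Algebra.Properties.Ring ring using (-‿distribˡ-*)
  open Convolution (PolyRing n)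
  open Determinants (PolyRing n) using (sign)
  open import Relation.Binary.Reasoning.Setoid setoid
  module MS = CMS *-commutativeMonoid

  signedElem : List (Fin n) → ℕ → Poly n
  signedElem Z j = sign j * elem j Z

  homSeq : List (Fin n) → ℕ → Poly n
  homSeq T m = hom m T

  elem-0 : ∀ (L : List (Fin n)) → elem 0 L P.≡ 1P
  elem-0 []      = P.refl
  elem-0 (v ∷ L) = elem-0 L

  elem-vanish : ∀ d (L : List (Fin n)) → length L < d → elem d L ≈ 0#
  elem-vanish (suc d) []      _         = refl
  elem-vanish (suc d) (v ∷ L) (s≤s l<d) = begin
    elem (suc d) L +P (var v *P elem d L) ≈⟨ trans (+P≋⊕ _ _) (+-congˡ (*P≋⊗ (var v) (elem d L))) ⟩
    elem (suc d) L + var v * elem d L     ≈⟨ +-cong (elem-vanish (suc d) L (ℕP.m<n⇒m<1+n l<d)) (*-congˡ (elem-vanish d L l<d)) ⟩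
    0# + var v * 0#                       ≈⟨ trans (+-identityˡ _) (zeroʳ _) ⟩
    0#                                    ∎

  signedElem-cons : ∀ t Z j → signedElem (t ∷ Z) j ≈ signedElem Z j + (- var t) * shiftRight (signedElem Z) j
  signedElem-cons t Z zero = begin
    signedElem Z 0                      ≈⟨ +-identityʳ (signedElem Z 0) ⟨
    signedElem Z 0 + 0#                 ≈⟨ +-congˡ {signedElem Z 0} (zeroʳ (- var t)) ⟨
    signedElem Z 0 + (- var t) * 0#     ∎
  signedElem-cons t Z (suc d) = begin
    (- s) * (elem (suc d) Z +P (var t *P elem d Z)) ≈⟨ *-congˡ { - s} (trans (+P≋⊕ _ _) (+-congˡ (*P≋⊗ (var t) (elem d Z)))) ⟩
    (- s) * (elem (suc d) Z + var t * elem d Z)     ≈⟨ distribˡ (- s) _ _ ⟩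
    (- s) * elem (suc d) Z + (- s) * (var t * elem d Z) ≈⟨ +-congˡ reorder ⟩
    (- s) * elem (suc d) Z + (- var t) * (s * elem d Z) ∎
    where
    s : Poly n
    s = sign d
    reorder : (- s) * (var t * elem d Z) ≈ (- var t) * (s * elem d Z)
    reorder = begin
      (- s) * (var t * elem d Z)   ≈⟨ -‿distribˡ-* s _ ⟨
      - (s * (var t * elem d Z))   ≈⟨ -‿cong (MS.solve 3 (λ a b c → a MS.⊕ (b MS.⊕ c) MS.⊜ b MS.⊕ (a MS.⊕ c)) refl s (var t) (elem d Z)) ⟩
      - (var t * (s * elem d Z))   ≈⟨ -‿distribˡ-* (var t) _ ⟩
      (- var t) * (s * elem d Z)   ∎

  homSeq-cons : ∀ t T m → homSeq (t ∷ T) m ≈ homSeq T m + var t * shiftRight (homSeq (t ∷ T)) m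
  homSeq-cons t T zero = begin
    homSeq T 0                 ≈⟨ +-identityʳ (homSeq T 0) ⟨
    homSeq T 0 + 0#            ≈⟨ +-congˡ {homSeq T 0} (zeroʳ (var t)) ⟨
    homSeq T 0 + var t * 0#    ∎
  homSeq-cons t T (suc d) = trans (+P≋⊕ (hom (suc d) T) (var t *P hom d (t ∷ T))) (+-congˡ (*P≋⊗ (var t) (hom d (t ∷ T))))

  E[T++X]*H[T]≈E[X] : ∀ T X c → conv (signedElem (T ++ X)) (homSeq T) c ≈ sign c * elem c X
  E[T++X]*H[T]≈E[X] [] X c = trans (conv-congʳ (signedElem X) c H[]≈δ) (conv-δ (signedElem X) c)
    where H[]≈δ : ∀ m → homSeq [] m ≈ δ m
          H[]≈δ zero    = refl
          H[]≈δ (suc m) = refl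
  E[T++X]*H[T]≈E[X] (t ∷ T) X c = begin
    conv (signedElem (t ∷ Z)) H c
      ≈⟨ conv-congˡ H c (signedElem-cons t Z) ⟩
    conv (λ j → E j + (- var t) * shiftRight E j) H c
      ≈⟨ conv-+ˡ E (λ j → (- var t) * shiftRight E j) H c ⟩
    conv E H c + conv (λ j → (- var t) * shiftRight E j) H c
      ≈⟨ +-cong (trans (conv-congʳ E c (homSeq-cons t T)) (conv-+ʳ E (homSeq T) (λ m → var t * shiftRight H m) c))
                (conv-*ˡ (- var t) (shiftRight E) H c) ⟩
    (conv E (homSeq T) c + conv E (λ m → var t * shiftRight H m) c) + (- var t) * conv (shiftRight E) H c
      ≈⟨ +-congʳ (+-congˡ (conv-*ʳ (var t) E (shiftRight H) c)) ⟩
    (conv E (homSeq T) c + var t * conv E (shiftRight H) c) + (- var t) * conv (shiftRight E) H c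
      ≈⟨ shiftedTermsCancel c ⟩
    conv E (homSeq T) c
      ≈⟨ E[T++X]*H[T]≈E[X] T X c ⟩
    sign c * elem c X ∎
    where
    Z : List (Fin n)
    Z = T ++ X
    E H : ℕ → Poly n
    E = signedElem Z
    H = homSeq (t ∷ T)
    -- x_t z E_Z H_{t∷T} appears once with each sign
    shiftedTermsCancel : ∀ c → (conv E (homSeq T) c + var t * conv E (shiftRight H) c) + (- var t) * conv (shiftRight E) H c
                               ≈ conv E (homSeq T) c
    shiftedTermsCancel zero = trans (+-cong (+-congˡ (trans (*-congˡ (conv-shiftʳ-0 E H)) (zeroʳ _)))
                                            (trans (*-congˡ (conv-shiftˡ-0 E H)) (zeroʳ _)))
                                    (trans (+-identityʳ _) (+-identityʳ _))
    shiftedTermsCancel (suc c) = begin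
      (x + var t * conv E (shiftRight H) (suc c)) + (- var t) * conv (shiftRight E) H (suc c)
        ≈⟨ +-cong (+-congˡ (*-congˡ (conv-shiftʳ E H c))) (*-congˡ (conv-shiftˡ E H c)) ⟩
      (x + var t * y) + (- var t) * y   ≈⟨ +-assoc x _ _ ⟩
      x + (var t * y + (- var t) * y)   ≈⟨ +-congˡ (+-congˡ (-‿distribˡ-* (var t) y)) ⟨
      x + (var t * y + - (var t * y))   ≈⟨ +-congˡ (-‿inverseʳ _) ⟩
      x + 0#                            ≈⟨ +-identityʳ x ⟩
      x                                 ∎
      where x y : Poly n
            x = conv E (homSeq T) (suc c)
            y = conv E H c

  E[Q]*H[P++Q]≈H[P] : ∀ P Q d → conv (signedElem Q) (homSeq (P ++ Q)) d ≈ hom d P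
  E[Q]*H[P++Q]≈H[P] [] Q d = begin
    conv (signedElem Q) (homSeq Q) d        ≈⟨ reflexive (P.cong (λ Z → conv (signedElem Z) (homSeq Q) d) (P.sym (ListP.++-identityʳ Q))) ⟩
    conv (signedElem (Q ++ [])) (homSeq Q) d ≈⟨ E[T++X]*H[T]≈E[X] Q [] d ⟩
    sign d * elem d []                      ≈⟨ E[]≈H[] d ⟩
    hom d []                                ∎
    where E[]≈H[] : ∀ d → sign d * elem d [] ≈ hom d []
          E[]≈H[] zero    = *-identityˡ _
          E[]≈H[] (suc d) = zeroʳ _
  E[Q]*H[P++Q]≈H[P] (u ∷ P) Q d = begin
    conv E (homSeq (u ∷ P ++ Q)) d
      ≈⟨ conv-congʳ E d (homSeq-cons u (P ++ Q)) ⟩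
    conv E (λ m → homSeq (P ++ Q) m + var u * shiftRight H m) d
      ≈⟨ conv-+ʳ E (homSeq (P ++ Q)) (λ m → var u * shiftRight H m) d ⟩
    conv E (homSeq (P ++ Q)) d + conv E (λ m → var u * shiftRight H m) d
      ≈⟨ +-cong (E[Q]*H[P++Q]≈H[P] P Q d) (conv-*ʳ (var u) E (shiftRight H) d) ⟩
    hom d P + var u * conv E (shiftRight H) d
      ≈⟨ shiftedTerm d ⟩
    hom d (u ∷ P) ∎
    where
    E H : ℕ → Poly n
    E = signedElem Q
    H = homSeq (u ∷ P ++ Q)
    shiftedTerm : ∀ d → hom d P + var u * conv E (shiftRight H) d ≈ hom d (u ∷ P)
    shiftedTerm zero    = trans (+-congˡ (trans (*-congˡ (conv-shiftʳ-0 E H)) (zeroʳ _))) (+-identityʳ _)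
    shiftedTerm (suc d) = begin
      hom (suc d) P + var u * conv E (shiftRight H) (suc d) ≈⟨ +-congˡ (*-congˡ (conv-shiftʳ E H d)) ⟩
      hom (suc d) P + var u * conv E H d                    ≈⟨ +-congˡ (*-congˡ (E[Q]*H[P++Q]≈H[P] (u ∷ P) Q d)) ⟩
      hom (suc d) P + var u * hom d (u ∷ P)                 ≈⟨ homSeq-cons u P (suc d) ⟨
      hom (suc d) (u ∷ P)                                   ∎

-- Neglex is a strict order compatible with multiplication of monomials.
-- Hence, if every monomial of f is ≤ a and every monomial of g is ≤ b, the
-- only contribution to x^{a+b} in f·g is (coeff f a)(coeff g b).  We track
-- leading terms with coefficient ±1 ('Leading'), which is preserved by
-- products and by adding lower-order terms, and implies 'LeadMon'.
module NegLexLeadingTerms (n : ℕ) where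

  open import Defs hiding (_≈_)
  open PolynomialRing
    using (coeff-++; termMul; coeff-termMul; Cofactor; cofactor; noCofactor; cofactor?;
           coeff-term-≡; coeff-term-≢; coeff-∷; _⊕_; _⊗_; ⊖; ⊕-def; ⊗-def; ⊖-def; cofactorCoeff)
  open import Data.Nat using (_+_; _<_)
  import Data.Nat.Properties as ℕP
  open import Data.Rational as ℚ using (ℚ; 0ℚ; 1ℚ)
  import Data.Rational.Properties as ℚP
  import Data.Fin.Properties as FinP
  open import Data.Vec using (Vec; []; _∷_; lookup; zipWith)
  import Data.Vec.Properties as VecP
  open import Data.List using ([]; _∷_; _++_; map)
  open import Data.List.Relation.Unary.All as All using (All; []; _∷_)
  import Data.List.Relation.Unary.All.Properties as AllP
  open import Data.List.Relation.Unary.Any using (Any; here; there)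
  open import Data.Product using (_×_; _,_; proj₂)
  open import Data.Sum using (_⊎_; inj₁; inj₂)
  open import Data.Empty using (⊥-elim)
  open import Relation.Nullary using (¬_; yes; no)
  open import Relation.Binary.Definitions using (tri<; tri≈; tri>)
  open import Relation.Binary.PropositionalEquality

  NegLex≤ : Mon n → Mon n → Set
  NegLex≤ a b = a ≡ b ⊎ NegLex< a b

  negLex-irrefl : ∀ {a : Mon n} → ¬ NegLex< a a
  negLex-irrefl (i , lt , _) = ℕP.<-irrefl refl lt

  negLex-trans : ∀ {a b c : Mon n} → NegLex< a b → NegLex< b c → NegLex< a c
  negLex-trans {a} {b} {c} (i , ab , ea) (i' , bc , eb) with FinP.<-cmp i i'
  ... | tri< i<i' _ _ = i' , subst (_< lookup c i') (sym (ea i' i<i')) bc , λ j i'<j → trans (ea j (FinP.<-trans i<i' i'<j)) (eb j i'<j)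
  ... | tri≈ _ refl _ = i , ℕP.<-trans ab bc , λ j i<j → trans (ea j i<j) (eb j i<j)
  ... | tri> _ _ i'<i = i , subst (lookup a i <_) (eb i i'<i) ab , λ j i<j → trans (ea j i<j) (eb j (FinP.<-trans i'<i i<j))

  negLex⇒≢ : ∀ {a b : Mon n} → NegLex< a b → a ≢ b
  negLex⇒≢ {a} lt refl = negLex-irrefl {a} lt

  negLex-≤-trans : ∀ {a b c : Mon n} → NegLex< a b → NegLex≤ b c → NegLex< a c
  negLex-≤-trans lt (inj₁ refl) = lt
  negLex-≤-trans {a} {b} {c} lt (inj₂ lt') = negLex-trans {a} {b} {c} lt lt'

  lookup-monMul : ∀ (a b : Mon n) i → lookup (monMul a b) i ≡ lookup a i + lookup b i
  lookup-monMul a b i = VecP.lookup-zipWith _+_ i a b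

  negLex-mulʳ : ∀ {a b : Mon n} (c : Mon n) → NegLex< a b → NegLex< (monMul a c) (monMul b c)
  negLex-mulʳ {a} {b} c (i , lt , e) =
    i , subst₂ _<_ (sym (lookup-monMul a c i)) (sym (lookup-monMul b c i)) (ℕP.+-monoˡ-< (lookup c i) lt) ,
    λ j i<j → trans (lookup-monMul a c j) (trans (cong (_+ lookup c j) (e j i<j)) (sym (lookup-monMul b c j)))

  negLex-mulˡ : ∀ (a : Mon n) {b c : Mon n} → NegLex< b c → NegLex< (monMul a b) (monMul a c)
  negLex-mulˡ a {b} {c} (i , lt , e) =
    i , subst₂ _<_ (sym (lookup-monMul a b i)) (sym (lookup-monMul a c i)) (ℕP.+-monoʳ-< (lookup a i) lt) ,
    λ j i<j → trans (lookup-monMul a b j) (trans (cong (lookup a j +_) (e j i<j)) (sym (lookup-monMul a c j)))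

  negLex≤-mul : ∀ {a b c d : Mon n} → NegLex≤ a b → NegLex≤ c d → NegLex≤ (monMul a c) (monMul b d)
  negLex≤-mul (inj₁ refl) (inj₁ refl) = inj₁ refl
  negLex≤-mul {a} {.a} {c} {d} (inj₁ refl) (inj₂ lt) = inj₂ (negLex-mulˡ a {c} {d} lt)
  negLex≤-mul {a} {b} {d} {.d} (inj₂ lt) (inj₁ refl) = inj₂ (negLex-mulʳ {a} {b} d lt)
  negLex≤-mul {a} {b} {c} {d} (inj₂ lt) (inj₂ lt') =
    inj₂ (negLex-trans {monMul a c} {monMul b c} {monMul b d} (negLex-mulʳ {a} {b} c lt) (negLex-mulˡ b {c} {d} lt'))

  negLex-mul-strict : ∀ {a b c d : Mon n} → NegLex< a b → NegLex≤ c d → NegLex< (monMul a c) (monMul b d)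
  negLex-mul-strict {a} {b} {c} {d} lt le =
    negLex-≤-trans {monMul a c} {monMul b c} {monMul b d} (negLex-mulʳ {a} {b} c lt) (negLex≤-mul {b} {b} {c} {d} (inj₁ refl) le)

  monMul-cancelˡ : ∀ {m} (a c d : Vec ℕ m) → zipWith _+_ a c ≡ zipWith _+_ a d → c ≡ d
  monMul-cancelˡ [] [] [] e = refl
  monMul-cancelˡ (x ∷ a) (y ∷ c) (z ∷ d) e =
    cong₂ _∷_ (ℕP.+-cancelˡ-≡ x y z (VecP.∷-injectiveˡ e)) (monMul-cancelˡ a c d (VecP.∷-injectiveʳ e))

  Supp : Poly n → (Mon n → Set) → Set
  Supp p P = All (λ t → P (proj₂ t)) p

  Supp-map : ∀ {p : Poly n} {P Q : Mon n → Set} → (∀ {m} → P m → Q m) → Supp p P → Supp p Q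
  Supp-map f s = All.map f s

  Supp-⊕ : ∀ {p q : Poly n} {P : Mon n → Set} → Supp p P → Supp q P → Supp (p ⊕ q) P
  Supp-⊕ {p} {q} s s' = subst (λ l → Supp l _) (sym (⊕-def p q)) (AllP.++⁺ s s')

  Supp-⊖ : ∀ {p : Poly n} {P : Mon n → Set} → Supp p P → Supp (⊖ p) P
  Supp-⊖ {p} s = subst (λ l → Supp l _) (sym (⊖-def p)) (AllP.map⁺ s)

  Supp-*P : ∀ {p q : Poly n} {P Q R : Mon n → Set} → Supp p P → Supp q Q →
    (∀ {a b} → P a → Q b → R (monMul a b)) → Supp (p *P q) R
  Supp-*P [] s' f = []
  Supp-*P {_ ∷ p} {q} (x ∷ s) s' f = AllP.++⁺ (AllP.map⁺ (All.map (f x) s')) (Supp-*P {p} {q} s s' f)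

  Supp-⊗ : ∀ {p q : Poly n} {P Q R : Mon n → Set} → Supp p P → Supp q Q →
    (∀ {a b} → P a → Q b → R (monMul a b)) → Supp (p ⊗ q) R
  Supp-⊗ {p} {q} s s' f = subst (λ l → Supp l _) (sym (⊗-def p q)) (Supp-*P {p} {q} s s' f)

  coeff-outsideSupp : ∀ (p : Poly n) m → Supp p (λ m' → m' ≢ m) → coeff p m ≡ 0ℚ
  coeff-outsideSupp [] m s = refl
  coeff-outsideSupp ((c , m') ∷ p) m (x ∷ s) with VecP.≡-dec ℕP._≟_ m' m
  ... | yes e = ⊥-elim (x e)
  ... | no _  = coeff-outsideSupp p m s

  coeff≢0⇒occurs : ∀ (p : Poly n) m → coeff p m ≢ 0ℚ → Any (λ t → proj₂ t ≡ m) p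
  coeff≢0⇒occurs [] m nz = ⊥-elim (nz refl)
  coeff≢0⇒occurs ((c , m') ∷ p) m nz with VecP.≡-dec ℕP._≟_ m' m
  ... | yes e = here e
  ... | no _  = there (coeff≢0⇒occurs p m nz)

  Supp-occurs : ∀ {p : Poly n} {P : Mon n → Set} {m} → Supp p P → Any (λ t → proj₂ t ≡ m) p → P m
  Supp-occurs (x ∷ s) (here refl) = x
  Supp-occurs (x ∷ s) (there a)   = Supp-occurs s a

  IsSign : ℚ → Set
  IsSign c = c ≡ 1ℚ ⊎ c ≡ ℚ.- 1ℚ

  isSign-* : ∀ {a b} → IsSign a → IsSign b → IsSign (a ℚ.* b)
  isSign-* (inj₁ refl) (inj₁ refl) = inj₁ refl
  isSign-* (inj₁ refl) (inj₂ refl) = inj₂ refl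
  isSign-* (inj₂ refl) (inj₁ refl) = inj₂ refl
  isSign-* (inj₂ refl) (inj₂ refl) = inj₁ refl

  isSign⇒≢0 : ∀ {a} → IsSign a → a ≢ 0ℚ
  isSign⇒≢0 (inj₁ refl) ()
  isSign⇒≢0 (inj₂ refl) ()

  Leading : Poly n → Mon n → Set
  Leading f m = IsSign (coeff f m) × Supp f (λ m' → NegLex≤ m' m)

  Leading⇒LeadMon : ∀ {f m} → Leading f m → LeadMon f m
  Leading⇒LeadMon {f} {m} (u , s) = isSign⇒≢0 u , λ m' nz → Supp-occurs s (coeff≢0⇒occurs f m' nz)

  coeff-*P-top : ∀ (f g : Poly n) a b → Supp f (λ m' → NegLex≤ m' a) → Supp g (λ m' → NegLex≤ m' b) →
    coeff (f *P g) (monMul a b) ≡ coeff f a ℚ.* coeff g b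
  coeff-*P-top [] g a b s s' = sym (ℚP.*-zeroˡ (coeff g b))
  coeff-*P-top ((c , mt) ∷ f) g a b (x ∷ s) s' = begin
    coeff (map (termMul (c , mt)) g ++ f *P g) (monMul a b)
      ≡⟨ coeff-++ (map (termMul (c , mt)) g) _ _ ⟩
    coeff (map (termMul (c , mt)) g) (monMul a b) ℚ.+ coeff (f *P g) (monMul a b)
      ≡⟨ cong₂ ℚ._+_ (firstTerm x) (coeff-*P-top f g a b s s') ⟩
    coeff ((c , mt) ∷ []) a ℚ.* coeff g b ℚ.+ coeff f a ℚ.* coeff g b
      ≡⟨ sym (ℚP.*-distribʳ-+ (coeff g b) (coeff ((c , mt) ∷ []) a) (coeff f a)) ⟩
    (coeff ((c , mt) ∷ []) a ℚ.+ coeff f a) ℚ.* coeff g b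
      ≡⟨ cong (ℚ._* coeff g b) (sym (coeff-∷ (c , mt) f a)) ⟩
    coeff ((c , mt) ∷ f) a ℚ.* coeff g b ∎
    where
    open ≡-Reasoning
    firstTerm : NegLex≤ mt a → coeff (map (termMul (c , mt)) g) (monMul a b) ≡ coeff ((c , mt) ∷ []) a ℚ.* coeff g b
    firstTerm (inj₁ refl) = trans (coeff-termMul c mt g (monMul mt b) d) (cofactorIs-b d)
      where
      d : Cofactor mt (monMul mt b)
      d = cofactor? mt (monMul mt b)
      cofactorIs-b : (d : Cofactor mt (monMul mt b)) → cofactorCoeff c g d ≡ coeff ((c , mt) ∷ []) mt ℚ.* coeff g b
      cofactorIs-b (cofactor m₀ _ e₀) = trans (cong (λ z → c ℚ.* coeff g z) (monMul-cancelˡ mt m₀ b e₀))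
                                              (cong (ℚ._* coeff g b) (sym (coeff-term-≡ c {mt} {mt} refl)))
      cofactorIs-b (noCofactor f) = ⊥-elim (f b refl)
    firstTerm (inj₂ lt) = trans
      (coeff-outsideSupp (map (termMul (c , mt)) g) (monMul a b)
        (AllP.map⁺ (All.map (λ {t} le → negLex⇒≢ {monMul mt (proj₂ t)} {monMul a b} (negLex-mul-strict {mt} {a} {proj₂ t} {b} lt le)) s')))
      (trans (sym (ℚP.*-zeroˡ (coeff g b))) (cong (ℚ._* coeff g b) (sym (coeff-term-≢ c {mt} {a} (negLex⇒≢ {mt} {a} lt)))))

  Leading-*P : ∀ {f g a b} → Leading f a → Leading g b → Leading (f *P g) (monMul a b)
  Leading-*P {f} {g} {a} {b} (u , s) (u' , s') =
    subst IsSign (sym (coeff-*P-top f g a b s s')) (isSign-* u u') , Supp-*P {f} {g} s s' negLex≤-mul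

  Leading-⊗ : ∀ {f g a b} → Leading f a → Leading g b → Leading (f ⊗ g) (monMul a b)
  Leading-⊗ {f} {g} {a} {b} l l' = subst (λ l → Leading l (monMul a b)) (sym (⊗-def f g)) (Leading-*P {f} {g} l l')

  Leading-++ : ∀ {f g m} → Leading f m → Supp g (λ m' → NegLex< m' m) → Leading (f ++ g) m
  Leading-++ {f} {g} {m} (u , s) s' =
    subst IsSign (sym (trans (coeff-++ f g m)
      (trans (cong (coeff f m ℚ.+_) (coeff-outsideSupp g m (All.map (λ {t} → negLex⇒≢ {proj₂ t} {m}) s'))) (ℚP.+-identityʳ _)))) u ,
    AllP.++⁺ s (All.map inj₂ s')

  Leading-⊕ : ∀ {f g m} → Leading f m → Supp g (λ m' → NegLex< m' m) → Leading (f ⊕ g) m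
  Leading-⊕ {f} {g} {m} l s' = subst (λ l → Leading l m) (sym (⊕-def f g)) (Leading-++ {f} {g} l s')

  Leading-mono : ∀ m → Leading (mono m) m
  Leading-mono m = inj₁ (coeff-term-≡ 1ℚ {m} {m} refl) , (inj₁ refl ∷ [])

-- Consequently, if the variables
-- of ws precede v, then h_e(ws ++ [v]) = h_e(ws) + x_w h_{e-1}(w ∷ …) has
-- leading monomial x_v^e: every other term has x_v-degree below e.
module HomLeadingMonomial (n : ℕ) where

  open import Defs hiding (_≈_)
  open NegLexLeadingTerms n
  open import Data.Nat using (zero; suc; _≤_; _<_; s≤s; z≤n; _+_)
  import Data.Nat.Properties as ℕP
  open import Data.Fin as Fin using (Fin; toℕ; fromℕ<)
  open import Data.Vec using (Vec; lookup; replicate; _[_]≔_)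
  import Data.Vec.Properties as VecP
  import Data.Fin.Properties as FinP
  import Data.List.Properties as ListP
  open import Data.List as List using (List; []; _∷_; _++_; take; tabulate)
  open import Data.List.Relation.Unary.All as All using (All; []; _∷_)
  import Data.List.Relation.Unary.All.Properties as AllP
  open import Data.Product using (_×_; _,_)
  open import Relation.Nullary using (Dec; yes; no)
  open import Relation.Binary.PropositionalEquality
  open import Function using (_∘_)

  lookup-ext : ∀ {m} {a b : Vec ℕ m} → (∀ i → lookup a i ≡ lookup b i) → a ≡ b
  lookup-ext {a = a} {b} e = trans (sym (VecP.tabulate∘lookup a)) (trans (VecP.tabulate-cong e) (VecP.tabulate∘lookup b))

  lookup-varPow-≡ : ∀ (v : Fin n) e → lookup (varPow v e) v ≡ e
  lookup-varPow-≡ v e = VecP.lookup∘update v (replicate n 0) e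

  lookup-varPow-≢ : ∀ (v : Fin n) e q → v ≢ q → lookup (varPow v e) q ≡ 0
  lookup-varPow-≢ v e q ne = trans (VecP.lookup∘update′ (λ e' → ne (sym e')) (replicate n 0) e) (VecP.lookup-replicate q 0)

  lookup-one : ∀ (q : Fin n) → lookup (replicate n 0) q ≡ 0
  lookup-one q = VecP.lookup-replicate q 0

  varPow-0 : ∀ (v : Fin n) → varPow v 0 ≡ replicate n 0
  varPow-0 v = trans (cong (replicate n 0 [ v ]≔_) (sym (lookup-one v))) (VecP.[]≔-lookup (replicate n 0) v)

  varPow-+ : ∀ (v : Fin n) a b → monMul (varPow v a) (varPow v b) ≡ varPow v (a + b)
  varPow-+ v a b = lookup-ext λ q → trans (lookup-monMul (varPow v a) (varPow v b) q) (atIndex q (v Fin.≟ q))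
    where atIndex : ∀ q → Dec (v ≡ q) → lookup (varPow v a) q + lookup (varPow v b) q ≡ lookup (varPow v (a + b)) q
          atIndex q (yes refl) = trans (cong₂ _+_ (lookup-varPow-≡ v a) (lookup-varPow-≡ v b)) (sym (lookup-varPow-≡ v (a + b)))
          atIndex q (no ne)    = trans (cong₂ _+_ (lookup-varPow-≢ v a q ne) (lookup-varPow-≢ v b q ne)) (sym (lookup-varPow-≢ v (a + b) q ne))

  monMul-identityˡ : ∀ (m : Mon n) → monMul (replicate n 0) m ≡ m
  monMul-identityˡ m = lookup-ext λ q → trans (lookup-monMul (replicate n 0) m q) (cong (_+ lookup m q) (lookup-one q))

  Below : ℕ → ℕ → Mon n → Set
  Below w b m = (∀ q → w < toℕ q → lookup m q ≡ 0) × (∀ q → toℕ q ≡ w → lookup m q ≤ b)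

  Below-mul : ∀ {w a b m₁ m₂} → Below w a m₁ → Below w b m₂ → Below w (a + b) (monMul m₁ m₂)
  Below-mul {w} {a} {b} {m₁} {m₂} (z₁ , b₁) (z₂ , b₂) =
    (λ q w<q → trans (lookup-monMul m₁ m₂ q) (cong₂ _+_ (z₁ q w<q) (z₂ q w<q))) ,
    (λ q e → subst (_≤ a + b) (sym (lookup-monMul m₁ m₂ q)) (ℕP.+-mono-≤ (b₁ q e) (b₂ q e)))

  Below-mono : ∀ {w a b m} → a ≤ b → Below w a m → Below w b m
  Below-mono a≤b (z , bd) = z , λ q e → ℕP.≤-trans (bd q e) a≤b

  Below-one : ∀ {w b} → Below w b (replicate n 0)
  Below-one = (λ q _ → lookup-one q) , (λ q _ → subst (_≤ _) (sym (lookup-one q)) z≤n)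

  Below-var≤ : ∀ {w} (x : Fin n) → toℕ x ≤ w → Below w 1 (varPow x 1)
  Below-var≤ {w} x x≤w =
    (λ q w<q → lookup-varPow-≢ x 1 q (λ e → ℕP.<-irrefl refl (ℕP.≤-<-trans x≤w (subst (λ z → w < toℕ z) (sym e) w<q)))) ,
    (λ q e → atMost1 q (x Fin.≟ q))
    where atMost1 : ∀ q → Dec (x ≡ q) → lookup (varPow x 1) q ≤ 1
          atMost1 q (yes refl) = subst (_≤ 1) (sym (lookup-varPow-≡ x 1)) ℕP.≤-refl
          atMost1 q (no ne)    = subst (_≤ 1) (sym (lookup-varPow-≢ x 1 q ne)) z≤n

  Below-var< : ∀ {w} (x : Fin n) → toℕ x < w → Below w 0 (varPow x 1)
  Below-var< {w} x x<w =
    (λ q w<q → lookup-varPow-≢ x 1 q (λ e → ℕP.<-asym x<w (subst (λ z → w < toℕ z) (sym e) w<q))) ,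
    (λ q e → subst (_≤ 0) (sym (lookup-varPow-≢ x 1 q (λ e' → ℕP.<-irrefl (trans (cong toℕ e') e) x<w))) z≤n)

  hom-Below : ∀ {w} e (L : List (Fin n)) → All (λ x → toℕ x ≤ w) L → Supp (hom e L) (Below w e)
  hom-Below zero    L h = Below-one ∷ []
  hom-Below (suc d) []  h = []
  hom-Below {w} (suc d) (x ∷ L) (hx ∷ h) = AllP.++⁺ (hom-Below (suc d) L h)
    (Supp-*P {var x} {hom d (x ∷ L)} (Below-var≤ x hx ∷ []) (hom-Below d (x ∷ L) (hx ∷ h))
      (λ {a} {b} → Below-mul {w} {1} {d} {a} {b}))

  hom-Below< : ∀ {w} e (L : List (Fin n)) → All (λ x → toℕ x < w) L → Supp (hom e L) (Below w 0)
  hom-Below< zero    L h = Below-one ∷ []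
  hom-Below< (suc d) []  h = []
  hom-Below< {w} (suc d) (x ∷ L) (hx ∷ h) = AllP.++⁺ (hom-Below< (suc d) L h)
    (Supp-*P {var x} {hom d (x ∷ L)} (Below-var< x hx ∷ []) (hom-Below< d (x ∷ L) (hx ∷ h))
      (λ {a} {b} → Below-mul {w} {0} {0} {a} {b}))

  Below⇒NegLex< : ∀ {w b m target} (v : Fin n) → toℕ v ≡ w → Below w b m → b < lookup target v →
    (∀ q → w < toℕ q → lookup target q ≡ 0) → NegLex< m target
  Below⇒NegLex< {w} {b} {m} {target} v e (z , bd) lt targetZero =
    v , ℕP.≤-<-trans (bd v e) lt ,
    λ q v<q → trans (z q (subst (_< toℕ q) e v<q)) (sym (targetZero q (subst (_< toℕ q) e v<q)))

  Leading-one : Leading 1P (replicate n 0)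
  Leading-one = Leading-mono (replicate n 0)

  Leading-hom : ∀ (ws : List (Fin n)) (v : Fin n) e → All (λ x → toℕ x < toℕ v) ws → Leading (hom e (ws ++ v ∷ [])) (varPow v e)
  Leading-hom ws v zero h = subst (Leading 1P) (sym (varPow-0 v)) Leading-one
  Leading-hom [] v (suc d) h = subst (Leading (var v *P hom d (v ∷ []))) (varPow-+ v 1 d)
    (Leading-*P {var v} {hom d (v ∷ [])} (Leading-mono (varPow v 1)) (Leading-hom [] v d []))
  Leading-hom (w ∷ ws) v (suc d) (hw ∷ h) =
    Leading-++ {hom (suc d) (ws ++ v ∷ [])} {var w *P hom d (w ∷ ws ++ v ∷ [])} (Leading-hom ws v (suc d) h)
      (Supp-map {var w *P hom d (w ∷ ws ++ v ∷ [])} {Below (toℕ v) d} (λ {m} → belowTarget {m})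
        (Supp-*P {var w} {hom d (w ∷ ws ++ v ∷ [])} (Below-var< w hw ∷ [])
          (hom-Below d (w ∷ ws ++ v ∷ []) (ℕP.<⇒≤ hw ∷ AllP.++⁺ (All.map ℕP.<⇒≤ h) (ℕP.≤-refl ∷ [])))
          (λ {a} {b} → Below-mul {toℕ v} {0} {d} {a} {b})))
    where
    belowTarget : ∀ {m} → Below (toℕ v) d m → NegLex< m (varPow v (suc d))
    belowTarget {m} bm = Below⇒NegLex< {toℕ v} {d} {m} {varPow v (suc d)} v refl bm
      (subst (d <_) (sym (lookup-varPow-≡ v (suc d))) ℕP.≤-refl)
      (λ q v<q → lookup-varPow-≢ v (suc d) q (λ e → ℕP.<-irrefl (cong toℕ e) v<q))

  firstVars : ℕ → List (Fin n)
  firstVars q = take q (List.allFin n)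

  take-tabulate-bound : ∀ {m} (f : Fin m → Fin n) o q → (∀ i → toℕ (f i) ≡ o + toℕ i) →
    All (λ x → toℕ x < o + q) (take q (tabulate f))
  take-tabulate-bound {zero}  f o zero    h = []
  take-tabulate-bound {zero}  f o (suc q) h = []
  take-tabulate-bound {suc m} f o zero    h = []
  take-tabulate-bound {suc m} f o (suc q) h =
    subst (_< o + suc q) (sym (h Fin.zero)) (ℕP.+-monoʳ-< o (s≤s z≤n)) ∷
    All.map (λ {x} lt → subst (toℕ x <_) (sym (ℕP.+-suc o q)) lt)
      (take-tabulate-bound (f ∘ Fin.suc) (suc o) q (λ i → trans (h (Fin.suc i)) (ℕP.+-suc o (toℕ i))))

  firstVars-bound : ∀ q → All (λ x → toℕ x < q) (firstVars q)
  firstVars-bound q = take-tabulate-bound (λ x → x) 0 q (λ i → refl)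

  firstVars-suc : ∀ q (q<n : q < n) → firstVars (suc q) ≡ firstVars q ++ fromℕ< q<n ∷ []
  firstVars-suc q q<n = subst (λ m → firstVars (suc m) ≡ firstVars m ++ fromℕ< q<n ∷ []) (FinP.toℕ-fromℕ< q<n)
    (ListP.take-suc-tabulate (λ x → x) (fromℕ< q<n))

-- For S ⊆ [n] (a bit vector s read from position p on) we form the matrix
-- with one row per element pᵣ ∈ S, whose entry in column j is
-- h_{pᵣ+1-a-j}(x₁,…,x_{n-pᵣ}) (zero if the degree is negative).  Expanding
-- along column 0, the term of the first row is h_{p+1-a}(x₁,…,x_{n-p}) times
-- the minor, which is the same kind of matrix for the remaining rows with a
-- increased by one; by induction its leading monomial is the product of the
-- x_{n-pᵣ}^{pᵣ+1-aᵣ}.  Every other term involves x_{n-p} to a power ≤ p-a only,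
-- so lies strictly below.  The resulting leading monomial 'skipTarget' is
-- identified with the reverse skip monomial x(S)* later.
module SkipDeterminantLeading (n : ℕ) where

  open import Defs hiding (_≈_)
  open PolynomialRing using (PolyRing; _⊗_)
  open Determinants (PolyRing n) using (det; sign; det-cong-≡)
  open NegLexLeadingTerms n
  open HomLeadingMonomial n
  open import Algebra.Properties.Semiring.Sum (CommutativeRing.semiring (PolyRing n)) using (sum)
  import Algebra.Properties.CommutativeMonoid.Sum as CMSum
  import Data.Nat.Properties as ℕP
  module ℕSum = CMSum ℕP.+-0-commutativeMonoid
  open import Data.Nat as ℕ using (zero; suc; _≤_; _<_; s≤s; z≤n; _+_; _∸_)
  open import Data.Bool using (Bool; true; false)
  open import Data.Fin as Fin using (Fin; toℕ; fromℕ<; punchIn)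
  import Data.Fin.Properties as FinP
  open import Data.Vec using (Vec; []; _∷_; lookup; replicate; tabulate)
  import Data.Vec.Properties as VecP
  open import Data.List using (List; []; _∷_)
  open import Data.List.Relation.Unary.All as All using (All; []; _∷_)
  open import Data.Product using (_,_)
  open import Data.Empty using (⊥-elim)
  open import Relation.Nullary using (yes; no)
  open import Relation.Binary.PropositionalEquality
  open import Function using (_∘_)

  homShifted : ℕ → ℕ → List (Fin n) → Poly n
  homShifted d       zero    L = hom d L
  homShifted zero    (suc j) L = 0P
  homShifted (suc d) (suc j) L = homShifted d j L

  card : ∀ {L} → Vec Bool L → ℕ
  card []          = 0
  card (true ∷ s)  = suc (card s)
  card (false ∷ s) = card s

  rowEntry : ℕ → ℕ → ℕ → Poly n
  rowEntry a p j = homShifted (suc p ∸ a) j (firstVars (n ∸ p))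

  skipMatrix : ∀ {L} (a p : ℕ) (s : Vec Bool L) → Fin (card s) → ℕ → Poly n
  skipMatrix a p (true ∷ s)  Fin.zero    = rowEntry a p
  skipMatrix a p (true ∷ s)  (Fin.suc r) = skipMatrix a (suc p) s r
  skipMatrix a p (false ∷ s) r           = skipMatrix a (suc p) s r

  pointExp : ℕ → ℕ → ℕ → ℕ
  pointExp x w d with x ℕ.≟ w
  ... | yes _ = d
  ... | no _  = 0

  -- the exponent of the variable of index x in the leading monomial: the
  -- element at position p, the (a+1)-st of S, contributes x_{n-p}^{p+1-a}
  skipExponent : ∀ {L} (a p : ℕ) → Vec Bool L → ℕ → ℕ
  skipExponent a p []          x = 0
  skipExponent a p (true ∷ s)  x = pointExp x (n ∸ suc p) (suc p ∸ a) + skipExponent (suc a) (suc p) s x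
  skipExponent a p (false ∷ s) x = skipExponent a (suc p) s x

  skipTarget : ∀ {L} (a p : ℕ) → Vec Bool L → Mon n
  skipTarget a p s = tabulate (λ q → skipExponent a p s (toℕ q))

  pointExp-≢ : ∀ x w d → x ≢ w → pointExp x w d ≡ 0
  pointExp-≢ x w d ne with x ℕ.≟ w
  ... | yes e = ⊥-elim (ne e)
  ... | no _  = refl

  pointExp-≡ : ∀ w d → pointExp w w d ≡ d
  pointExp-≡ w d with w ℕ.≟ w
  ... | yes _ = refl
  ... | no ne = ⊥-elim (ne refl)

  Supp-sign : ∀ k → Supp (sign k) (_≡ replicate n 0)
  Supp-sign zero    = refl ∷ []
  Supp-sign (suc k) = Supp-⊖ {sign k} (Supp-sign k)

  Supp-sum : ∀ {t} (f : Fin t → Poly n) {P : Mon n → Set} → (∀ r → Supp (f r) P) → Supp (sum f) P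
  Supp-sum {zero}  f h = []
  Supp-sum {suc t} f h = Supp-⊕ {f Fin.zero} {sum (f ∘ Fin.suc)} (h Fin.zero) (Supp-sum (f ∘ Fin.suc) (h ∘ Fin.suc))

  det-Below : ∀ {w} t (M : Fin t → ℕ → Poly n) (β : Fin t → ℕ) → (∀ r i → Supp (M r i) (Below w (β r))) →
    Supp (det t M) (Below w (ℕSum.sum β))
  det-Below zero M β h = Below-one ∷ []
  det-Below {w} (suc t) M β h = Supp-sum _ λ r →
    Supp-⊗ {sign (toℕ r)} {M r 0 ⊗ minor r} (Supp-sign (toℕ r))
      (Supp-⊗ {M r 0} {minor r} (h r 0)
        (det-Below t (λ r' i → M (punchIn r r') (suc i)) (β ∘ punchIn r) (λ r' i → h (punchIn r r') (suc i)))
        (λ {a} {b} → Below-mul {w} {β r} {ℕSum.sum (β ∘ punchIn r)} {a} {b}))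
      (λ {a} {b} a≡1 below → subst₂ (Below w) (sym (ℕSum.sum-remove {i = r} β))
                                (sym (trans (cong (λ z → monMul z b) a≡1) (monMul-identityˡ b))) below)
    where minor : Fin (suc t) → Poly n
          minor r = det t (λ r' i → M (punchIn r r') (suc i))

  homShifted-Below : ∀ {w} d j (L : List (Fin n)) → All (λ x → toℕ x ≤ w) L → Supp (homShifted d j L) (Below w (d ∸ j))
  homShifted-Below d       zero    L h = hom-Below d L h
  homShifted-Below zero    (suc j) L h = []
  homShifted-Below (suc d) (suc j) L h = homShifted-Below d j L h

  homShifted-Below< : ∀ {w} d j (L : List (Fin n)) → All (λ x → toℕ x < w) L → Supp (homShifted d j L) (Below w 0)
  homShifted-Below< d       zero    L h = hom-Below< d L h
  homShifted-Below< zero    (suc j) L h = []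
  homShifted-Below< (suc d) (suc j) L h = homShifted-Below< d j L h

  skipMatrix-shift : ∀ {L} (s : Vec Bool L) a p → a ≤ p → ∀ r i → skipMatrix a p s r (suc i) ≡ skipMatrix (suc a) p s r i
  skipMatrix-shift (true ∷ s)  a p a≤p Fin.zero    i = cong (λ d → homShifted d (suc i) (firstVars (n ∸ p))) (ℕP.+-∸-assoc 1 a≤p)
  skipMatrix-shift (true ∷ s)  a p a≤p (Fin.suc r) i = skipMatrix-shift s a (suc p) (ℕP.m≤n⇒m≤1+n a≤p) r i
  skipMatrix-shift (false ∷ s) a p a≤p r           i = skipMatrix-shift s a (suc p) (ℕP.m≤n⇒m≤1+n a≤p) r i

  skipMatrix-Below< : ∀ {L} (s : Vec Bool L) a p' w → n ∸ p' ≤ w → ∀ r i → Supp (skipMatrix a p' s r i) (Below w 0)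
  skipMatrix-Below< (true ∷ s) a p' w le Fin.zero i =
    homShifted-Below< (suc p' ∸ a) i (firstVars (n ∸ p')) (All.map (λ lt → ℕP.<-≤-trans lt le) (firstVars-bound (n ∸ p')))
  skipMatrix-Below< (true ∷ s) a p' w le (Fin.suc r) i =
    skipMatrix-Below< s a (suc p') w (ℕP.≤-trans (ℕP.∸-monoʳ-≤ n (ℕP.n≤1+n p')) le) r i
  skipMatrix-Below< (false ∷ s) a p' w le r i =
    skipMatrix-Below< s a (suc p') w (ℕP.≤-trans (ℕP.∸-monoʳ-≤ n (ℕP.n≤1+n p')) le) r i

  ∸-suc-< : ∀ p → p < n → n ∸ suc p < n ∸ p
  ∸-suc-< p p<n = subst (n ∸ suc p <_) (sym (ℕP.+-∸-assoc 1 p<n)) ℕP.≤-refl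

  +-suc-≡⇒< : ∀ {p L} → p + suc L ≡ n → p < n
  +-suc-≡⇒< {p} {L} e = subst (p <_) e (subst (_≤ p + suc L) (ℕP.+-comm p 1) (ℕP.+-monoʳ-≤ p (s≤s z≤n)))

  skipExponent-beyond : ∀ {L} (s : Vec Bool L) a p x → p + L ≡ n → n ∸ p ≤ x → skipExponent a p s x ≡ 0
  skipExponent-beyond [] a p x e le = refl
  skipExponent-beyond {suc L} (true ∷ s) a p x e le = cong₂ _+_
    (pointExp-≢ x (n ∸ suc p) (suc p ∸ a) (λ eq → ℕP.<-irrefl (sym eq) (ℕP.<-≤-trans (∸-suc-< p (+-suc-≡⇒< e)) le)))
    (skipExponent-beyond s (suc a) (suc p) x (trans (sym (ℕP.+-suc p L)) e) (ℕP.≤-trans (ℕP.∸-monoʳ-≤ n (ℕP.n≤1+n p)) le))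
  skipExponent-beyond {suc L} (false ∷ s) a p x e le =
    skipExponent-beyond s a (suc p) x (trans (sym (ℕP.+-suc p L)) e) (ℕP.≤-trans (ℕP.∸-monoʳ-≤ n (ℕP.n≤1+n p)) le)

  laterTerm-Below : ∀ t (M : Fin (suc t) → ℕ → Poly n) w d′ →
    (∀ i → Supp (M Fin.zero (suc i)) (Below w d′)) → (∀ r i → Supp (M (Fin.suc r) i) (Below w 0)) →
    ∀ r → Supp (sign (suc (toℕ r)) ⊗ (M (Fin.suc r) 0 ⊗ det t (λ r' i → M (punchIn (Fin.suc r) r') (suc i)))) (Below w d′)
  laterTerm-Below (suc t) M w d′ firstRow laterRows r =
    Supp-⊗ {sign (suc (toℕ r))} {M (Fin.suc r) 0 ⊗ minor} (Supp-sign (suc (toℕ r)))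
      (Supp-⊗ {M (Fin.suc r) 0} {minor} (laterRows r 0)
        (subst (λ z → Supp minor (Below w z)) sumβ≡d′ (det-Below (suc t) (λ r' i → M (punchIn (Fin.suc r) r') (suc i)) β entriesBelow))
        (λ {x} {y} → Below-mul {w} {0} {d′} {x} {y}))
      (λ {x} {y} x≡1 below → subst (Below w d′) (sym (trans (cong (λ z → monMul z y) x≡1) (monMul-identityˡ y))) below)
    where
    minor : Poly n
    minor = det (suc t) (λ r' i → M (punchIn (Fin.suc r) r') (suc i))
    β : Fin (suc t) → ℕ
    β Fin.zero    = d′
    β (Fin.suc _) = 0
    sumβ≡d′ : ℕSum.sum {suc t} β ≡ d′
    sumβ≡d′ = trans (cong (d′ +_) (ℕSum.sum-replicate-zero t)) (ℕP.+-identityʳ d′)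
    entriesBelow : ∀ r' i → Supp (M (punchIn (Fin.suc r) r') (suc i)) (Below w (β r'))
    entriesBelow Fin.zero      i = firstRow i
    entriesBelow (Fin.suc r'') i = laterRows (punchIn r r'') (suc i)

  module ExpansionStep {L} (s : Vec Bool L) (a p : ℕ) (a≤p : a ≤ p) (e : p + suc L ≡ n) where
    t : ℕ
    t = card s
    M : Fin (suc t) → ℕ → Poly n
    M = skipMatrix a p (true ∷ s)
    target : Mon n
    target = skipTarget a p (true ∷ s)
    e′ : suc p + L ≡ n
    e′ = trans (sym (ℕP.+-suc p L)) e
    p<n : p < n
    p<n = +-suc-≡⇒< e
    -- the first row contributes the variable x_w, with w = n - p - 1 (0-based)
    w : ℕ
    w = n ∸ suc p
    n∸p≡1+w : n ∸ p ≡ suc w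
    n∸p≡1+w = ℕP.+-∸-assoc 1 p<n
    w<n : w < n
    w<n = ℕP.<-≤-trans (∸-suc-< p p<n) (ℕP.m∸n≤m n p)
    v : Fin n
    v = fromℕ< w<n
    toℕv≡w : toℕ v ≡ w
    toℕv≡w = FinP.toℕ-fromℕ< w<n
    d d′ : ℕ
    d = suc p ∸ a
    d′ = p ∸ a
    d≡1+d′ : d ≡ suc d′
    d≡1+d′ = ℕP.+-∸-assoc 1 a≤p

    firstEntry-Leading : Leading (hom d (firstVars (n ∸ p))) (varPow v d)
    firstEntry-Leading = subst (λ l → Leading (hom d l) (varPow v d)) (sym (trans (cong firstVars n∸p≡1+w) (firstVars-suc w w<n)))
      (Leading-hom (firstVars w) v d (subst (λ z → All (λ x → toℕ x < z) (firstVars w)) (sym toℕv≡w) (firstVars-bound w)))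

    firstMinor firstTerm laterTerms : Poly n
    firstMinor = det t (λ r' i → M (Fin.suc r') (suc i))
    firstTerm = sign 0 ⊗ (M Fin.zero 0 ⊗ firstMinor)
    laterTerms = sum {t} (λ r → sign (suc (toℕ r)) ⊗ (M (Fin.suc r) 0 ⊗ det t (λ r' i → M (punchIn (Fin.suc r) r') (suc i))))

    lookup-target : ∀ q → lookup target q ≡ pointExp (toℕ q) w d + skipExponent (suc a) (suc p) s (toℕ q)
    lookup-target q = VecP.lookup∘tabulate (λ q → skipExponent a p (true ∷ s) (toℕ q)) q

    target≡ : monMul (replicate n 0) (monMul (varPow v d) (skipTarget (suc a) (suc p) s)) ≡ target
    target≡ = trans (monMul-identityˡ _) (lookup-ext λ q → trans (lookup-monMul (varPow v d) (skipTarget (suc a) (suc p) s) q)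
      (trans (cong₂ _+_ (varPow-as-pointExp q) (VecP.lookup∘tabulate (λ q → skipExponent (suc a) (suc p) s (toℕ q)) q))
             (sym (lookup-target q))))
      where
      varPow-as-pointExp : ∀ q → lookup (varPow v d) q ≡ pointExp (toℕ q) w d
      varPow-as-pointExp q with toℕ q ℕ.≟ w
      ... | yes eq = subst (λ z → lookup (varPow v d) z ≡ d) (FinP.toℕ-injective (trans toℕv≡w (sym eq))) (lookup-varPow-≡ v d)
      ... | no ne  = lookup-varPow-≢ v d q (λ eq → ne (trans (cong toℕ (sym eq)) toℕv≡w))

    firstTerm-Leading : Leading (det t (skipMatrix (suc a) (suc p) s)) (skipTarget (suc a) (suc p) s) → Leading firstTerm target
    firstTerm-Leading minorLeading = subst (Leading firstTerm) target≡
      (Leading-⊗ {1P} {M Fin.zero 0 ⊗ firstMinor} Leading-one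
        (Leading-⊗ {hom d (firstVars (n ∸ p))} {firstMinor} firstEntry-Leading
          (subst (λ X → Leading X (skipTarget (suc a) (suc p) s))
                 (sym (det-cong-≡ t (skipMatrix-shift s a (suc p) (ℕP.m≤n⇒m≤1+n a≤p)))) minorLeading)))

    target-at-w : d′ < lookup target v
    target-at-w = subst (d′ <_) (sym (trans (lookup-target v)
        (cong₂ _+_ (trans (cong (λ z → pointExp z w d) toℕv≡w) (pointExp-≡ w d))
                   (skipExponent-beyond s (suc a) (suc p) (toℕ v) e′ (subst (w ≤_) (sym toℕv≡w) ℕP.≤-refl)))))
      (subst (d′ <_) (sym (trans (ℕP.+-identityʳ d) d≡1+d′)) ℕP.≤-refl)

    target-beyond-w : ∀ q → w < toℕ q → lookup target q ≡ 0
    target-beyond-w q w<q = trans (lookup-target q)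
      (cong₂ _+_ (pointExp-≢ (toℕ q) w d (λ eq → ℕP.<-irrefl (sym eq) w<q))
                 (skipExponent-beyond s (suc a) (suc p) (toℕ q) e′ (ℕP.<⇒≤ w<q)))

    firstRowLater : ∀ i → Supp (M Fin.zero (suc i)) (Below w d′)
    firstRowLater i = Supp-map {homShifted d (suc i) (firstVars (n ∸ p))}
      (λ {m} → Below-mono {w} {d ∸ suc i} {d′} {m} (subst (λ z → z ∸ suc i ≤ d′) (sym d≡1+d′) (ℕP.m∸n≤m d′ i)))
      (homShifted-Below d (suc i) (firstVars (n ∸ p))
        (All.map (λ {x} lt → ℕP.≤-pred (subst (toℕ x <_) n∸p≡1+w lt)) (firstVars-bound (n ∸ p))))

    laterTerms-below : Supp laterTerms (λ m → NegLex< m target)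
    laterTerms-below = Supp-sum _ (λ r → Supp-map {_} {Below w d′}
      (λ {m} below → Below⇒NegLex< {w} {d′} {m} {target} v toℕv≡w below target-at-w target-beyond-w)
      (laterTerm-Below t M w d′ firstRowLater (skipMatrix-Below< s a (suc p) w ℕP.≤-refl) r))

  Leading-det : ∀ {L} (s : Vec Bool L) a p → a ≤ p → p + L ≡ n → Leading (det (card s) (skipMatrix a p s)) (skipTarget a p s)
  Leading-det [] a p a≤p e =
    subst (Leading 1P) (lookup-ext (λ q → trans (lookup-one q) (sym (VecP.lookup∘tabulate (λ _ → 0) q)))) Leading-one
  Leading-det {suc L} (false ∷ s) a p a≤p e = Leading-det s a (suc p) (ℕP.m≤n⇒m≤1+n a≤p) (trans (sym (ℕP.+-suc p L)) e)
  Leading-det {suc L} (true ∷ s) a p a≤p e =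
    Leading-⊕ {firstTerm} {laterTerms} {target} (firstTerm-Leading (Leading-det s (suc a) (suc p) (s≤s a≤p) e′)) laterTerms-below
    where open ExpansionStep s a p a≤p e

module Ideals (n : ℕ) (G : Poly n → Set) where

  open import Defs
  open PolynomialRing using (_≋_; get; coeff-++; concatMap-nil; *-distribˡ; *-assoc; *-congʳ; *-identityˡ;
                             PolyRing; _⊕_; _⊗_; ⊕-def; ⊗-def)
  open HomLeadingMonomial n using (lookup-ext)
  open import Data.Nat using (_+_; _∸_)
  import Data.Nat.Properties as ℕP
  open import Data.Rational as ℚ using (1ℚ)
  open import Data.Vec using (lookup; zipWith)
  import Data.Vec.Properties as VecP
  import Data.Rational.Properties as ℚP
  open import Data.List using (List; []; _∷_; _++_; map)
  import Data.List.Properties as ListP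
  open import Data.List.Relation.Unary.All as All using ([]; _∷_)
  import Data.List.Relation.Unary.All.Properties as AllP
  open import Data.Product using (_×_; _,_; proj₁; proj₂)
  open import Relation.Binary.PropositionalEquality
  open CommutativeRing (PolyRing n) using (0#)

  private
    termOf : Poly n × Poly n → Poly n
    termOf qg = proj₁ qg *P proj₂ qg

    sumP-++ : ∀ (cs cs' : List (Poly n × Poly n)) → sumP (map termOf (cs ++ cs')) ≡ sumP (map termOf cs) ++ sumP (map termOf cs')
    sumP-++ []       cs' = refl
    sumP-++ (c ∷ cs) cs' = trans (cong (termOf c ++_) (sumP-++ cs cs')) (sym (ListP.++-assoc (termOf c) _ _))

    *-sumP : ∀ (a : Poly n) (cs : List (Poly n × Poly n)) →
      (a *P sumP (map termOf cs)) ≈ sumP (map termOf (map (λ qg → (a *P proj₁ qg , proj₂ qg)) cs))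
    *-sumP a []             m = cong (λ l → coeff l m) (concatMap-nil a)
    *-sumP a ((q , g) ∷ cs) m = trans (*-distribˡ a (q *P g) _ m) (trans (coeff-++ (a *P (q *P g)) _ m)
      (trans (cong₂ ℚ._+_ (sym (*-assoc a q g m)) (*-sumP a cs m)) (sym (coeff-++ ((a *P q) *P g) _ m))))

  I-resp : ∀ {p q : Poly n} → p ≈ q → InIdeal G p → InIdeal G q
  I-resp e (cs , inG , eq) = cs , inG , λ m → trans (sym (e m)) (eq m)

  I-0 : InIdeal G 0P
  I-0 = [] , [] , λ m → refl

  I-gen : ∀ {g : Poly n} → G g → InIdeal G g
  I-gen {g} h = ((1P , g) ∷ []) , (h ∷ []) ,
    λ m → trans (sym (*-identityˡ g m)) (sym (trans (coeff-++ (1P *P g) [] m) (ℚP.+-identityʳ _)))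

  I-+P : ∀ {p q : Poly n} → InIdeal G p → InIdeal G q → InIdeal G (p +P q)
  I-+P {p} {q} (cs , inG , eq) (cs' , inG' , eq') = cs ++ cs' , AllP.++⁺ inG inG' ,
    λ m → trans (coeff-++ p q m) (trans (cong₂ ℚ._+_ (eq m) (eq' m))
            (trans (sym (coeff-++ (sumP (map termOf cs)) _ m)) (cong (λ l → coeff l m) (sym (sumP-++ cs cs')))))

  I-*P : ∀ (a : Poly n) {p : Poly n} → InIdeal G p → InIdeal G (a *P p)
  I-*P a {p} (cs , inG , eq) = map (λ qg → (a *P proj₁ qg , proj₂ qg)) cs , AllP.map⁺ inG ,
    λ m → trans (*-congʳ a eq m) (*-sumP a cs m)

  I-≋ : ∀ {x y} → x ≋ y → InIdeal G x → InIdeal G y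
  I-≋ {x} {y} e = I-resp {x} {y} (get e)

  I-0# : InIdeal G 0#
  I-0# = I-0

  I-⊕ : ∀ {x y} → InIdeal G x → InIdeal G y → InIdeal G (x ⊕ y)
  I-⊕ {x} {y} ix iy = I-resp {x +P y} {x ⊕ y} (λ m → cong (λ l → coeff l m) (sym (⊕-def x y))) (I-+P {x} {y} ix iy)

  I-⊗ : ∀ a {x} → InIdeal G x → InIdeal G (a ⊗ x)
  I-⊗ a {x} ix = I-resp {a *P x} {a ⊗ x} (λ m → cong (λ l → coeff l m) (sym (⊗-def a x))) (I-*P a ix)

  I-divisible : ∀ {a m : Mon n} → a ∣ᵐ m → InIdeal G (mono a) → InIdeal G (mono m)
  I-divisible {a} {m} a∣m h = I-resp {mono c *P mono a} {mono m} (λ q → cong (λ l → coeff l q) (sym m≡c*a)) (I-*P (mono c) {mono a} h)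
    where
    c : Mon n
    c = zipWith _∸_ m a
    m≡c*a : mono m ≡ mono c *P mono a
    m≡c*a = cong₂ (λ x y → (x , y) ∷ []) (sym (ℚP.*-identityˡ 1ℚ)) (lookup-ext λ q → sym (begin
      lookup (monMul c a) q          ≡⟨ VecP.lookup-zipWith _+_ q c a ⟩
      lookup c q + lookup a q        ≡⟨ cong (_+ lookup a q) (VecP.lookup-zipWith _∸_ q m a) ⟩
      lookup m q ∸ lookup a q + lookup a q ≡⟨ ℕP.m∸n+n≡m (a∣m q) ⟩
      lookup m q                     ∎))
      where open ≡-Reasoning

-- For |S| = n - k + 1 the skip determinant of S lies in J: by Cramer's rule
-- it suffices that for each row (position p) the combination
-- Σ_{j < |S|} (-1)ʲ eⱼ(x₁,…,xₙ) h_{p+1-j}(x₁,…,x_{n-p}) lies in J.  Extended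
-- to all j ≤ p+1 this sum is (-1)^{p+1} e_{p+1}(x_{n-p+1},…,xₙ) = 0, and the
-- terms with j ≥ |S| = n+1-k are multiples of the generators eⱼ(xₙ).  Its
-- leading monomial is x(S)*, so x(S)* ∈ in_<(J).
module ReverseSkipMonomials (n k : ℕ) (α : List ℕ) where

  open import Defs hiding (_≈_)
  open PolynomialRing using (PolyRing; _⊕_; _≋_; mk≋; get; ⊕-def; coeff-++)
  open CommutativeRing (PolyRing n) hiding (zero)
  open Determinants (PolyRing n) using (det; sign)
  open Convolution (PolyRing n)
  open SymmetricFunctionIdentities n using (signedElem; homSeq; E[T++X]*H[T]≈E[X]; elem-vanish; elem-0)
  open NegLexLeadingTerms n using (Leading; Leading⇒LeadMon)
  open HomLeadingMonomial n using (firstVars; lookup-ext)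
  open SkipDeterminantLeading n
  open Ideals n (JGen n k α)
  open import Algebra.Properties.Semiring.Sum (CommutativeRing.semiring (PolyRing n)) using (sum)
  open import Data.Nat as ℕ using (zero; suc; _≤_; _<_; s≤s; z≤n; _∸_)
  import Data.Nat.Properties as ℕP
  open import Data.Rational as ℚ using (ℚ; 0ℚ; 1ℚ)
  import Data.Rational.Properties as ℚP
  open import Data.Bool using (Bool; true; false)
  open import Data.Fin as Fin using (Fin; toℕ; opposite)
  import Data.Fin.Properties as FinP
  open import Data.Fin.Subset using (Subset; ∣_∣)
  open import Data.Vec using (Vec; []; _∷_; lookup; reverse; _∷ʳ_)
  import Data.Vec.Properties as VecP
  open import Data.List using (List; _++_; drop; length)
  import Data.List.Properties as ListP
  open import Data.Product using (Σ; _×_; _,_)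
  open import Data.Sum using (inj₁)
  open import Relation.Binary.PropositionalEquality as P using (_≡_)
  open import Relation.Binary.Reasoning.Setoid setoid
  open import Relation.Nullary using (yes; no)

  I : Poly n → Set
  I = InIdeal (JGen n k α)

  ℚ-cancel2 : ∀ (c : ℚ) → c ℚ.+ c ≡ 0ℚ → c ≡ 0ℚ
  ℚ-cancel2 c e = P.trans (P.sym (ℚP.*-identityʳ c)) (P.trans (P.cong (c ℚ.*_) 1≡½+½)
    (P.trans (ℚP.*-distribˡ-+ c ℚ.½ ℚ.½) (P.trans (P.sym (ℚP.*-distribʳ-+ ℚ.½ c c))
    (P.trans (P.cong (ℚ._* ℚ.½) e) (ℚP.*-zeroˡ ℚ.½)))))
    where 1≡½+½ : 1ℚ ≡ ℚ.½ ℚ.+ ℚ.½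
          1≡½+½ = P.refl

  -- ℚ[x] has characteristic 0, so determinants over it are alternating
  poly-cancel2 : ∀ x → (x ⊕ x) ≋ 0# → x ≋ 0#
  poly-cancel2 x e = mk≋ λ m → ℚ-cancel2 (coeff x m)
    (P.trans (P.sym (coeff-++ x x m)) (P.trans (P.cong (λ l → coeff l m) (P.sym (⊕-def x x))) (get e m)))

  open Determinants.Alternating (PolyRing n) poly-cancel2
  open Cramer I I-≋ I-0# I-⊕ I-⊗

  homShifted-≤ : ∀ c j (L : List (Fin n)) → j ≤ c → homShifted c j L ≡ hom (c ∸ j) L
  homShifted-≤ c       zero    L _         = P.refl
  homShifted-≤ (suc c) (suc j) L (s≤s j≤c) = homShifted-≤ c j L j≤c

  homShifted-> : ∀ c j (L : List (Fin n)) → c < j → homShifted c j L ≡ 0P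
  homShifted-> zero    (suc j) L _        = P.refl
  homShifted-> (suc c) (suc j) L (s≤s lt) = homShifted-> c j L lt

  module RowCombination (D : ℕ) (D+k≡1+n : D ℕ.+ k ≡ suc n) (p : ℕ) (p<n : p < n) where
    T X : List (Fin n)
    T = firstVars (n ∸ p)
    X = drop (n ∸ p) (allVars n)
    c : ℕ
    c = suc p
    term : ℕ → Poly n
    term j = signedElem (allVars n) j * homShifted c j T

    allVars≡T++X : allVars n ≡ T ++ X
    allVars≡T++X = P.sym (ListP.take++drop≡id (n ∸ p) (allVars n))

    length-X : length X ≡ p
    length-X = P.trans (ListP.length-drop (n ∸ p) (allVars n))
      (P.trans (P.cong (ℕ._∸ (n ∸ p)) (ListP.length-tabulate (λ x → x))) (ℕP.m∸[m∸n]≡n (ℕP.<⇒≤ p<n)))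

    -- summed over all j ≤ c, the combination is ± e_c(X) = 0
    fullSum≈0 : sumTo (suc c) term ≈ 0#
    fullSum≈0 = begin
      sumTo (suc c) term
        ≈⟨ sumTo-cong (suc c) term (λ j → signedElem (T ++ X) j * hom (c ∸ j) T)
             (λ j j< → reflexive (P.cong₂ (λ Z h → signedElem Z j * h) allVars≡T++X (homShifted-≤ c j T (ℕP.≤-pred j<)))) ⟩
      conv (signedElem (T ++ X)) (homSeq T) c ≈⟨ E[T++X]*H[T]≈E[X] T X c ⟩
      sign c * elem c X                       ≈⟨ *-congˡ (elem-vanish c X (P.subst (ℕ._< c) (P.sym length-X) ℕP.≤-refl)) ⟩
      sign c * 0#                             ≈⟨ zeroʳ _ ⟩
      0#                                      ∎

    sumTo-beyond : ∀ m → sumTo (suc c ℕ.+ m) term ≈ sumTo (suc c) term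
    sumTo-beyond zero    = reflexive (P.cong (λ z → sumTo z term) (ℕP.+-identityʳ (suc c)))
    sumTo-beyond (suc m) = begin
      sumTo (suc c ℕ.+ suc m) term            ≈⟨ reflexive (P.cong (λ z → sumTo z term) (ℕP.+-suc (suc c) m)) ⟩
      sumTo (suc (suc c ℕ.+ m)) term          ≈⟨ sumTo-last (suc c ℕ.+ m) term ⟩
      sumTo (suc c ℕ.+ m) term + term (suc c ℕ.+ m)
        ≈⟨ +-cong (sumTo-beyond m) (trans (*-congˡ (reflexive (homShifted-> c (suc c ℕ.+ m) T (s≤s (ℕP.m≤m+n c m))))) (zeroʳ _)) ⟩
      sumTo (suc c) term + 0#                 ≈⟨ +-identityʳ _ ⟩
      sumTo (suc c) term                      ∎

    -- for j ≥ D the term is a multiple of the generator eⱼ(xₙ) (or zero when j > n)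
    term-inJ : ∀ j → D ≤ j → I (term j)
    term-inJ j D≤j with j ℕ.≤? n
    ... | yes j≤n = I-≋ (trans (*-assoc (homShifted c j T) (sign j) (elem j (allVars n)))
                              (*-comm (homShifted c j T) (sign j * elem j (allVars n))))
                        (I-⊗ (homShifted c j T * sign j) (I-gen (inj₁ (j , j≤n , n<j+k , P.refl))))
      where n<j+k : n < j ℕ.+ k
            n<j+k = P.subst (_≤ j ℕ.+ k) D+k≡1+n (ℕP.+-monoˡ-≤ k D≤j)
    ... | no j≰n = I-≋ (sym (trans (*-congʳ (trans (*-congˡ (elem-vanish j (allVars n) j>length)) (zeroʳ _))) (zeroˡ _))) I-0#
      where j>length = P.subst (_< j) (P.sym (ListP.length-tabulate (λ x → x))) (ℕP.≰⇒> j≰n)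

    truncate : ∀ m → I (sumTo (D ℕ.+ m) term) → I (sumTo D term)
    truncate zero    h = I-≋ (reflexive (P.cong (λ z → sumTo z term) (ℕP.+-identityʳ D))) h
    truncate (suc m) h = truncate m (I-≋ dropLast (I-⊕ h′ (I-⊗ (- 1#) (term-inJ (D ℕ.+ m) (ℕP.m≤m+n D m)))))
      where
      h′ : I (sumTo (suc (D ℕ.+ m)) term)
      h′ = I-≋ (reflexive (P.cong (λ z → sumTo z term) (ℕP.+-suc D m))) h
      dropLast : sumTo (suc (D ℕ.+ m)) term + (- 1#) * term (D ℕ.+ m) ≈ sumTo (D ℕ.+ m) term
      dropLast = begin
        sumTo (suc (D ℕ.+ m)) term + (- 1#) * term (D ℕ.+ m)  ≈⟨ +-cong (sumTo-last (D ℕ.+ m) term) (-1*x≈-x _) ⟩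
        (sumTo (D ℕ.+ m) term + term (D ℕ.+ m)) + - term (D ℕ.+ m) ≈⟨ +-assoc _ _ _ ⟩
        sumTo (D ℕ.+ m) term + (term (D ℕ.+ m) + - term (D ℕ.+ m)) ≈⟨ +-congˡ (-‿inverseʳ _) ⟩
        sumTo (D ℕ.+ m) term + 0#                             ≈⟨ +-identityʳ _ ⟩
        sumTo (D ℕ.+ m) term                                  ∎
        where open import Algebra.Properties.Ring ring using (-1*x≈-x)

    rowCombination-inJ : I (sumTo D term)
    rowCombination-inJ = truncate (suc c) (I-≋ (sym (trans (reflexive (P.cong (λ z → sumTo z term) (ℕP.+-comm D (suc c))))
                                                            (trans (sumTo-beyond D) fullSum≈0))) I-0#)

  skipMatrix-rows : ∀ {L} (s : Vec Bool L) p₀ → p₀ ℕ.+ L ≡ n → ∀ r →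
    Σ ℕ (λ p → p < n × (∀ j → skipMatrix 0 p₀ s r j ≡ rowEntry 0 p j))
  skipMatrix-rows {suc L} (true ∷ s)  p₀ e Fin.zero    = p₀ , +-suc-≡⇒< e , λ j → P.refl
  skipMatrix-rows {suc L} (true ∷ s)  p₀ e (Fin.suc r) = skipMatrix-rows s (suc p₀) (P.trans (P.sym (ℕP.+-suc p₀ L)) e) r
  skipMatrix-rows {suc L} (false ∷ s) p₀ e r           = skipMatrix-rows s (suc p₀) (P.trans (P.sym (ℕP.+-suc p₀ L)) e) r

  det-inJ : ∀ D (M : Fin D → ℕ → Poly n) → D ℕ.+ k ≡ suc n →
    (∀ r → Σ ℕ (λ p → p < n × (∀ j → M r j ≡ rowEntry 0 p j))) → I (det D M)
  det-inJ zero    M e rows = I-gen (inj₁ (0 , z≤n , P.subst (n <_) (P.sym e) ℕP.≤-refl , P.sym (elem-0 (allVars n))))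
  det-inJ (suc t) M e rows = cramer t M (signedElem (allVars n)) E₀≈1 rowInJ
    where
    E₀≈1 : signedElem (allVars n) 0 ≈ 1#
    E₀≈1 = trans (*-identityˡ _) (reflexive (elem-0 (allVars n)))
    rowInJ : ∀ r → I (sum {suc t} (λ j → signedElem (allVars n) (toℕ j) * M r (toℕ j)))
    rowInJ r with rows r
    ... | p , p<n , Mr≡ = I-≋ (sym (trans (sum≈sumTo (suc t) (λ j → signedElem (allVars n) j * M r j))
                                     (sumTo-cong (suc t) _ (RowCombination.term (suc t) e p p<n)
                                       (λ j _ → reflexive (P.cong (signedElem (allVars n) j *_) (Mr≡ j))))))
                            (RowCombination.rowCombination-inJ (suc t) e p p<n)

  card≡∣∣ : ∀ {L} (S : Vec Bool L) → ∣ S ∣ ≡ card S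
  card≡∣∣ []          = P.refl
  card≡∣∣ (true ∷ S)  = P.cong suc (card≡∣∣ S)
  card≡∣∣ (false ∷ S) = card≡∣∣ S

  skipExponent≡skipGo : ∀ {L} (s : Vec Bool L) a p → p ℕ.+ L ≡ n → ∀ (y : Fin L) x → x ≡ n ∸ suc (p ℕ.+ toℕ y) →
    skipExponent a p s x ≡ lookup (skipGo p a s) y
  skipExponent≡skipGo {suc L} (b ∷ s) a p e Fin.zero x x≡ = firstPosition b
    where
    e′ : suc p ℕ.+ L ≡ n
    e′ = P.trans (P.sym (ℕP.+-suc p L)) e
    x≡w : x ≡ n ∸ suc p
    x≡w = P.trans x≡ (P.cong (λ z → n ∸ suc z) (ℕP.+-identityʳ p))
    beyond : ∀ a → skipExponent a (suc p) s x ≡ 0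
    beyond a = skipExponent-beyond s a (suc p) x e′ (ℕP.≤-reflexive (P.sym x≡w))
    firstPosition : ∀ b → skipExponent a p (b ∷ s) x ≡ lookup (skipGo p a (b ∷ s)) Fin.zero
    firstPosition true  = P.trans (P.cong₂ ℕ._+_ (P.trans (P.cong (λ z → pointExp z (n ∸ suc p) (suc p ∸ a)) x≡w)
                                                            (pointExp-≡ (n ∸ suc p) (suc p ∸ a))) (beyond (suc a)))
                                  (ℕP.+-identityʳ _)
    firstPosition false = beyond a
  skipExponent≡skipGo {suc L} (b ∷ s) a p e (Fin.suc y) x x≡ = laterPosition b
    where
    e′ : suc p ℕ.+ L ≡ n
    e′ = P.trans (P.sym (ℕP.+-suc p L)) e
    x≡′ : x ≡ n ∸ suc (suc p ℕ.+ toℕ y)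
    x≡′ = P.trans x≡ (P.cong (λ z → n ∸ suc z) (ℕP.+-suc p (toℕ y)))
    x<w : x < n ∸ suc p
    x<w = P.subst (_< n ∸ suc p) (P.sym x≡′)
      (ℕP.∸-monoʳ-< (s≤s (ℕP.m≤m+n (suc p) (toℕ y)))
        (P.subst (suc (suc p ℕ.+ toℕ y) ≤_) e′ (ℕP.+-monoʳ-< (suc p) (FinP.toℕ<n y))))
    laterPosition : ∀ b → skipExponent a p (b ∷ s) x ≡ lookup (skipGo p a (b ∷ s)) (Fin.suc y)
    laterPosition true  = P.trans (P.cong (ℕ._+ skipExponent (suc a) (suc p) s x)
                                          (pointExp-≢ x (n ∸ suc p) (suc p ∸ a) (λ eq → ℕP.<-irrefl eq x<w)))
                                  (skipExponent≡skipGo s (suc a) (suc p) e′ y x x≡′)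
    laterPosition false = skipExponent≡skipGo s a (suc p) e′ y x x≡′

  lookup-∷ʳ-last : ∀ {L} (v : Vec ℕ L) x → lookup (v ∷ʳ x) (Fin.fromℕ L) ≡ x
  lookup-∷ʳ-last []      x = P.refl
  lookup-∷ʳ-last (y ∷ v) x = lookup-∷ʳ-last v x

  lookup-∷ʳ-inject₁ : ∀ {L} (v : Vec ℕ L) x (i : Fin L) → lookup (v ∷ʳ x) (Fin.inject₁ i) ≡ lookup v i
  lookup-∷ʳ-inject₁ (y ∷ v) x Fin.zero    = P.refl
  lookup-∷ʳ-inject₁ (y ∷ v) x (Fin.suc i) = lookup-∷ʳ-inject₁ v x i

  lookup-reverse-opposite : ∀ {L} (v : Vec ℕ L) (i : Fin L) → lookup (reverse v) (opposite i) ≡ lookup v i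
  lookup-reverse-opposite (x ∷ v) i = P.trans (P.cong (λ w → lookup w (opposite i)) (VecP.reverse-∷ x v)) (atOpposite i)
    where
    atOpposite : ∀ i → lookup (reverse v ∷ʳ x) (opposite i) ≡ lookup (x ∷ v) i
    atOpposite Fin.zero    = lookup-∷ʳ-last (reverse v) x
    atOpposite (Fin.suc i) = P.trans (lookup-∷ʳ-inject₁ (reverse v) x (opposite i)) (lookup-reverse-opposite v i)

  skipTarget≡revSkip : ∀ (S : Subset n) → skipTarget 0 0 S ≡ revSkip S
  skipTarget≡revSkip S = lookup-ext λ q →
    P.trans (VecP.lookup∘tabulate (λ q → skipExponent 0 0 S (toℕ q)) q)                  -- skipExponent 0 0 S (toℕ q)
    (P.trans (skipExponent≡skipGo S 0 0 P.refl (opposite q) (toℕ q) (q≡ q))              -- skipGo 0 0 S at opposite q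
    (P.trans (P.sym (lookup-reverse-opposite (skipGo 0 0 S) (opposite q)))               -- revSkip S at opposite (opposite q)
             (P.cong (lookup (revSkip S)) (FinP.opposite-involutive q))))
    where
    q≡ : ∀ q → toℕ q ≡ n ∸ suc (toℕ (opposite q))
    q≡ q = P.trans (P.cong toℕ (P.sym (FinP.opposite-involutive q))) (FinP.opposite-prop (opposite q))

  reverseSkip-inInitial : ∀ (S : Subset n) → ∣ S ∣ ℕ.+ k ≡ suc n → InInitial (JGen n k α) (mono (revSkip S))
  reverseSkip-inInitial S e = Ideals.I-gen n (InitGen (JGen n k α)) {mono (revSkip S)}
    (skipDet , revSkip S ,
     det-inJ (card S) (skipMatrix 0 0 S) (P.trans (P.cong (ℕ._+ k) (P.sym (card≡∣∣ S))) e) (skipMatrix-rows S 0 P.refl) ,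
     Leading⇒LeadMon (P.subst (Leading skipDet) (skipTarget≡revSkip S) (Leading-det S 0 0 z≤n P.refl)) ,
     λ m → P.refl)
    where skipDet = det (card S) (skipMatrix 0 0 S)

-- Let x^{(i)} = ch be a block of size αᵢ ≤ k, v its (j+1)-st variable and
-- d = k - j.  Splitting ch = P ++ Q with P = the first j+1 variables,
-- h_d(P) = Σᵢ (-1)ⁱ eᵢ(Q) h_{d-i}(ch); each term is zero (i > |Q|) or a
-- multiple of a generator h_{d-i}(x^{(i)}) (since d - i > k - αᵢ).  As the
-- variables of a block are increasing, h_d(P) has leading monomial x_v^d.
module BlockVariablePowers (n k : ℕ) (α : List ℕ) where

  open import Defs hiding (_≈_)
  open PolynomialRing using (PolyRing)
  open CommutativeRing (PolyRing n) hiding (zero)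
  open Convolution (PolyRing n) using (sumTo; conv)
  open SymmetricFunctionIdentities n using (signedElem; homSeq; E[Q]*H[P++Q]≈H[P]; elem-vanish)
  open NegLexLeadingTerms n using (Leading; Leading⇒LeadMon)
  open HomLeadingMonomial n using (Leading-hom)
  open ReverseSkipMonomials n k α using (I)
  open Ideals n (JGen n k α)
  open import Data.Nat as ℕ using (zero; suc; _≤_; _<_; s≤s; z≤n; _∸_)
  import Data.Nat.Properties as ℕP
  open import Data.Fin as Fin using (Fin; toℕ)
  import Data.Fin.Properties as FinP
  open import Data.List using ([]; _∷_; _++_; take; drop; length; zip; lookup)
  import Data.List.Properties as ListP
  open import Data.List.Relation.Unary.All as All using (All; []; _∷_)
  open import Data.List.Relation.Unary.AllPairs using (AllPairs; []; _∷_)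
  import Data.List.Relation.Unary.AllPairs.Properties as AllPairsP
  open import Data.List.Membership.Propositional using (_∈_)
  open import Data.List.Relation.Unary.Any using (here; there)
  open import Data.Product using (_×_; _,_; proj₁; proj₂)
  open import Data.Sum using (inj₂)
  open import Relation.Binary.PropositionalEquality as P using (_≡_)
  open import Relation.Nullary using (yes; no)

  Increasing : List (Fin n) → Set
  Increasing = AllPairs (λ x y → toℕ x < toℕ y)

  block-facts : ∀ (α′ : List ℕ) (xs : List (Fin n)) → Increasing xs → ∀ {b} → b ∈ zip α′ (chunks α′ xs) →
    (proj₁ b ∈ α′) × (length (proj₂ b) ≤ proj₁ b) × Increasing (proj₂ b)
  block-facts (a ∷ as) xs inc (here P.refl) =
    here P.refl , P.subst (_≤ a) (P.sym (ListP.length-take a xs)) (ℕP.m⊓n≤m a (length xs)) , AllPairsP.take⁺ a inc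
  block-facts (a ∷ as) xs inc (there m) with block-facts as (drop a xs) (AllPairsP.drop⁺ a inc) m
  ... | a∈ , len , inc′ = there a∈ , len , inc′

  take-before-lookup : ∀ (L : List (Fin n)) (j : Fin (length L)) → Increasing L →
    All (λ x → toℕ x < toℕ (lookup L j)) (take (toℕ j) L)
  take-before-lookup (x ∷ L) Fin.zero    inc              = []
  take-before-lookup (x ∷ L) (Fin.suc j) (x<L ∷ inc) = All-lookup L x<L j ∷ take-before-lookup L j inc
    where
    All-lookup : ∀ {Pr : Fin n → Set} (L : List (Fin n)) → All Pr L → (j : Fin (length L)) → Pr (lookup L j)
    All-lookup (x ∷ L) (px ∷ pxs) Fin.zero    = px
    All-lookup (x ∷ L) (px ∷ pxs) (Fin.suc j) = All-lookup L pxs j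

  I-sumTo : ∀ N (f : ℕ → Poly n) → (∀ i → i < N → I (f i)) → I (sumTo N f)
  I-sumTo zero    f h = I-0#
  I-sumTo (suc N) f h = I-⊕ (h 0 (s≤s z≤n)) (I-sumTo N (λ i → f (suc i)) (λ i lt → h (suc i) (s≤s lt)))

  module Block (a : ℕ) (ch : List (Fin n)) (ch∈ : (a , ch) ∈ blocks n α)
               (a≤k : a ≤ k) (len≤a : length ch ≤ a) (j : Fin (length ch)) where
    v : Fin n
    v = lookup ch j
    d : ℕ
    d = k ∸ toℕ j
    Pre Suf : List (Fin n)
    Pre = take (suc (toℕ j)) ch
    Suf = drop (suc (toℕ j)) ch

    j<a : toℕ j < a
    j<a = ℕP.<-≤-trans (FinP.toℕ<n j) len≤a

    hom-isGenerator : ∀ i → i ℕ.+ suc (toℕ j) ≤ a → JGen n k α (hom (d ∸ i) ch)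
    hom-isGenerator i i+j<a = inj₂ ((a , ch) , ch∈ , d ∸ i , ℕP.≤-trans (ℕP.m∸n≤m d i) (ℕP.m∸n≤m k (toℕ j)) , k<d-i+a , P.refl)
      where
      i≤d : i ≤ d
      i≤d = ℕP.≤-trans (ℕP.m+n≤o⇒m≤o∸n i (ℕP.≤-trans i+j<a a≤k)) (ℕP.∸-monoʳ-≤ k (ℕP.n≤1+n (toℕ j)))
      j≤k : toℕ j ≤ k
      j≤k = ℕP.<⇒≤ (ℕP.<-≤-trans j<a a≤k)
      d-i+i+j+1≡1+k : (d ∸ i) ℕ.+ (i ℕ.+ suc (toℕ j)) ≡ suc k
      d-i+i+j+1≡1+k = P.trans (P.sym (ℕP.+-assoc (d ∸ i) i (suc (toℕ j))))
        (P.trans (P.cong (ℕ._+ suc (toℕ j)) (ℕP.m∸n+n≡m i≤d)) (P.trans (ℕP.+-suc d (toℕ j)) (P.cong suc (ℕP.m∸n+n≡m j≤k))))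
      k<d-i+a : k < (d ∸ i) ℕ.+ a
      k<d-i+a = P.subst (_≤ (d ∸ i) ℕ.+ a) d-i+i+j+1≡1+k (ℕP.+-monoʳ-≤ (d ∸ i) i+j<a)

    term-inJ : ∀ i → i < suc d → I (signedElem Suf i * hom (d ∸ i) ch)
    term-inJ i _ with i ℕ.≤? length Suf
    ... | yes i≤len = I-⊗ (signedElem Suf i) (I-gen (hom-isGenerator i i+j<a))
      where
      i+j<a : i ℕ.+ suc (toℕ j) ≤ a
      i+j<a = ℕP.m≤o∸n⇒m+n≤o i j<a (ℕP.≤-trans i≤len
        (P.subst (_≤ a ∸ suc (toℕ j)) (P.sym (ListP.length-drop (suc (toℕ j)) ch)) (ℕP.∸-monoˡ-≤ (suc (toℕ j)) len≤a)))
    ... | no i≰len = I-≋ (sym (trans (*-congʳ (trans (*-congˡ (elem-vanish i Suf (ℕP.≰⇒> i≰len))) (zeroʳ _))) (zeroˡ _))) I-0#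

    homPre-inJ : I (hom d Pre)
    homPre-inJ = I-≋ (trans (reflexive (P.cong (λ L → conv (signedElem Suf) (homSeq L) d) (P.sym (ListP.take++drop≡id (suc (toℕ j)) ch))))
                            (E[Q]*H[P++Q]≈H[P] Pre Suf d))
                     (I-sumTo (suc d) (λ i → signedElem Suf i * hom (d ∸ i) ch) term-inJ)

    homPre-Leading : Increasing ch → Leading (hom d Pre) (varPow v d)
    homPre-Leading inc = P.subst (λ l → Leading (hom d l) (varPow v d)) (P.sym (ListP.take-suc ch j))
      (Leading-hom (take (toℕ j) ch) v d (take-before-lookup ch j inc))

  blockPower-inInitial : All (λ a → 1 ≤ a × a ≤ k) α → (b : ℕ × List (Fin n)) → b ∈ blocks n α →
    (j : Fin (length (proj₂ b))) → InInitial (JGen n k α) (mono (varPow (lookup (proj₂ b) j) (k ∸ toℕ j)))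
  blockPower-inInitial αBounds (a , ch) ch∈ j =
    Ideals.I-gen n (InitGen (JGen n k α)) {mono (varPow v d)}
      (hom d Pre , varPow v d , homPre-inJ , Leading⇒LeadMon (homPre-Leading inc) , λ m → P.refl)
    where
    facts : (a ∈ α) × (length ch ≤ a) × Increasing ch
    facts = block-facts α (allVars n) (AllPairsP.tabulate⁺-< (λ i<j → i<j)) ch∈
    inc : Increasing ch
    inc = proj₂ (proj₂ facts)
    open Block a ch ch∈ (proj₂ (All.lookup αBounds (proj₁ facts))) (proj₁ (proj₂ facts)) j

open import Defs
open import Data.Nat using (ℕ; suc; _+_; _∸_; _≤_; _<_)
open import Data.Nat.ListAction using (sum)
open import Data.Fin using (Fin; toℕ)
open import Data.Fin.Subset using (Subset; ∣_∣)
open import Data.List using (List; length; lookup)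
open import Data.List.Relation.Unary.All using (All)
open import Data.List.Membership.Propositional using (_∈_)
open import Data.Product using (_×_; _,_; proj₂)
open import Relation.Nullary using (¬_)
open import Relation.Binary.PropositionalEquality using (_≡_)

standard⇒nonSkip : ∀ n k α → All (λ a → 1 ≤ a × a ≤ k) α →
  (m : Mon n) → ¬ InInitial (JGen n k α) (mono m) → NonSkip n k α m
standard⇒nonSkip n k α αBounds m m∉ =
  (λ S e x[S]*∣m → m∉ (I-divisible {revSkip S} {m} x[S]*∣m (ReverseSkipMonomials.reverseSkip-inInitial n k α S e))) ,
  (λ b b∈ j xᵈ∣m → m∉ (I-divisible {varPow (lookup (proj₂ b) j) (k ∸ toℕ j)} {m} xᵈ∣m
                         (BlockVariablePowers.blockPower-inInitial n k α αBounds b b∈ j)))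
  where open Ideals n (InitGen (JGen n k α)) using (I-divisible)

lemma3p7 : (n k : ℕ) (α : List ℕ) → 0 < k →
    All (λ a → 1 ≤ a × a ≤ k) α → sum α ≡ n →
    ((S : Subset n) → ∣ S ∣ + k ≡ suc n →
       InInitial (JGen n k α) (mono (revSkip S)))
    ×
    ((b : ℕ × List (Fin n)) → b ∈ blocks n α →
       (j : Fin (length (proj₂ b))) →
       InInitial (JGen n k α) (mono (varPow (lookup (proj₂ b) j) (k ∸ toℕ j))))
    ×
    ((m : Mon n) → ¬ InInitial (JGen n k α) (mono m) → NonSkip n k α m)
lemma3p7 n k α _ αBounds _ =
  ReverseSkipMonomials.reverseSkip-inInitial n k α ,
  BlockVariablePowers.blockPower-inInitial n k α αBounds ,
  standard⇒nonSkip n k α αBounds
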